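{- Let $G$ be a finite Cayley integral group. Then every subgroup of $G$ and every homomorphic image of $G$ is also Cayley integral.
   Context: For a group $G$ and a symmetric subset $S\subseteq G$ ($S=S^{ -1}$), the Cayley graph $\mathrm{Cay}(G,S)$ has vertex set $G$ and adjacency matrix $A$ with $A_{x,y}=1$ iff $xy^{ -1}\in S$. A graph is integral if all eigenvalues of its adjacency matrix are integers. A group $G$ is Cayley integral if $\mathrm{Cay}(G,S)$ is integral for every symmetric subset $S$ of $G$. -}

module Defs where

open import Data.Nat using (ℕ; zero; suc)
open import Data.Fin using (Fin; zero; suc; punchIn; toℕ)
open import Data.Fin.Subset using (Subset; _∈_)
open import Data.Bool using (if_then_else_)
open import Data.Integer using (ℤ; _+_; _*_; _-_; -_; 0ℤ; 1ℤ)
open import Data.Vec using (lookup)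
open import Data.Product using (∃; Σ)
open import Relation.Binary.PropositionalEquality using (_≡_)
open import Algebra.Structures using (IsGroup)
open import Function.Definitions using (Injective; Surjective)

Matrix : ℕ → Set
Matrix n = Fin n → Fin n → ℤ

∑ : ∀ n → (Fin n → ℤ) → ℤ
∑ zero    f = 0ℤ
∑ (suc n) f = f zero + ∑ n (λ i → f (suc i))

∏ : ∀ n → (Fin n → ℤ) → ℤ
∏ zero    f = 1ℤ
∏ (suc n) f = f zero * ∏ n (λ i → f (suc i))

sign : ℕ → ℤ
sign zero    = 1ℤ
sign (suc k) = - sign k

det : ∀ n → Matrix n → ℤ
det zero    M = 1ℤ
det (suc n) M = ∑ (suc n) λ j → sign (toℕ j) * (M zero j * det n (λ r c → M (suc r) (punchIn j c)))

δ : ∀ {n} → Fin n → Fin n → ℤ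
δ zero    zero    = 1ℤ
δ zero    (suc _) = 0ℤ
δ (suc _) zero    = 0ℤ
δ (suc i) (suc j) = δ i j

charPoly : ∀ n → Matrix n → ℤ → ℤ
charPoly n A x = det n (λ i j → x * δ i j - A i j)

-- A matrix is integral iff all its eigenvalues (the roots of χ_A, with
-- multiplicity) are integers, i.e. χ_A(x) = ∏ (x - λᵢ) with λᵢ ∈ ℤ.
-- (Two integer polynomials agreeing on all of ℤ are equal.)
IntegralMatrix : ∀ n → Matrix n → Set
IntegralMatrix n A = Σ (Fin n → ℤ) λ λs → ∀ (x : ℤ) → charPoly n A x ≡ ∏ n (λ i → x - λs i)

-- A finite group: carrier Fin n (every finite group is isomorphic to one).
record FinGroup (n : ℕ) : Set where
  field
    _∙_ : Fin n → Fin n → Fin n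
    ε   : Fin n
    _⁻¹ : Fin n → Fin n
    isGroup : IsGroup _≡_ _∙_ ε _⁻¹

open FinGroup public

Symmetric : ∀ {n} → FinGroup n → Subset n → Set
Symmetric G S = ∀ x → x ∈ S → _⁻¹ G x ∈ S

cayleyAdj : ∀ {n} → FinGroup n → Subset n → Matrix n
cayleyAdj G S x y = if lookup S (_∙_ G x (_⁻¹ G y)) then 1ℤ else 0ℤ

CayleyIntegral : ∀ {n} → FinGroup n → Set
CayleyIntegral {n} G = ∀ (S : Subset n) → Symmetric G S → IntegralMatrix n (cayleyAdj G S)

IsHom : ∀ {n m} → FinGroup n → FinGroup m → (Fin n → Fin m) → Set
IsHom G H f = ∀ x y → f (_∙_ G x y) ≡ _∙_ H (f x) (f y)

-- H is (isomorphic to) a subgroup of G: injective homomorphism H → G.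
IsSubgroupOf : ∀ {m n} → FinGroup m → FinGroup n → Set
IsSubgroupOf {m} {n} H G = Σ (Fin m → Fin n) λ f → IsHom H G f × Injective _≡_ _≡_ f
  where open import Data.Product using (_×_)

IsHomImageOf : ∀ {k n} → FinGroup k → FinGroup n → Set
IsHomImageOf {k} {n} K G = Σ (Fin n → Fin k) λ f → IsHom G K f × Surjective _≡_ _≡_ f
  where open import Data.Product using (_×_)

-- A matrix is integral iff its characteristic polynomial splits over ℤ, and a monic factor
-- of an integer polynomial that splits over ℤ splits over ℤ as well.
-- For S ⊆ H ≤ G, ordering G by the right cosets of H makes Cay(G, S) block diagonal with one
-- copy of Cay(H, S) per coset, so χ_G = χ_H ^ [G : H].
-- For a surjection f : G → K with kernel of size c, Cay(G, f⁻¹ S) has adjacency matrix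
-- (r, s) ↦ A (f r) (f s), where A is that of Cay(K, S); merging the points of each fibre
-- gives χ_G x = x ^ (|G| - |K|) * χ_{c A} x.  Hence the eigenvalues of c A are integers c λ,
-- and each λ, a rational root of the monic integer polynomial χ_A, is an integer.
module Submission where

open import Level using (0ℓ)
open import Data.Nat as ℕ using (ℕ; zero; suc; _≤_; z≤n; s≤s)
import Data.Nat.Properties as ℕ
open import Data.Nat.Divisibility as ℕ using (divides; ∣1⇒≡1)
open import Data.Nat.GCD using (gcd; gcd[m,n]∣m; gcd[m,n]∣n; gcd[m,n]≢0)
open import Data.Nat.Coprimality as Coprime using (Coprime; coprime-/gcd; coprime-divisor)
open import Data.Nat.DivMod using (_/_; m*n/n≡m)
open import Data.Bool using (Bool; true; false; if_then_else_)
open import Data.Fin using (Fin; zero; suc; punchIn; toℕ; _≟_)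
open import Data.Fin.Properties using (any?; nonZeroIndex)
open import Data.Fin.Subset using (Subset)
open import Data.Integer as ℤ
  using (ℤ; +_; -[1+_]; _+_; _*_; _-_; -_; 0ℤ; 1ℤ; _^_; ∣_∣; _◃_; NonZero; ≢-nonZero)
open import Data.Integer.Properties hiding (_≟_)
open import Data.Integer.Tactic.RingSolver using (solve-∀)
import Data.Sign as Sign
import Data.Sign.Properties as Sign
open import Data.List using (List; []; _∷_; _++_; [_]; map; length; filter; tabulate; allFin)
open import Data.List.Properties
  using (++-assoc; length-map; length-++; length-filter; length-tabulate; filter-reject; partition-defn)
open import Data.List.Membership.Propositional using (_∈_; _∉_; find)
open import Data.List.Membership.Propositional.Properties
  using (∈-∃++; ∈-map⁺; ∈-map⁻; ∈-filter⁺; ∈-filter⁻; ∈-allFin)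
open import Data.List.Membership.Propositional.Properties.WithK using (unique∧set⇒bag)
open import Data.List.Relation.Unary.All as All using ()
import Data.List.Relation.Unary.All.Properties as Allₚ
open import Data.List.Relation.Unary.Any as Any using (here; there)
open import Data.List.Relation.Unary.AllPairs as AllPairs using ([]; _∷_)
open import Data.List.Relation.Unary.Unique.Propositional using (Unique)
import Data.List.Relation.Unary.Unique.Propositional.Properties as Unique
open import Data.List.Relation.Binary.Subset.Propositional using (_⊆_)
open import Data.List.Relation.Binary.BagAndSetEquality using (∼bag⇒↭)
open import Data.List.Relation.Binary.Permutation.Propositional as ↭ using (_↭_; ↭-sym; ↭⇒↭ₛ; ↭ₛ⇒↭)
open import Data.List.Relation.Binary.Permutation.Propositional.Properties using (shift; ∈-resp-↭; ↭-length)
import Data.List.Relation.Binary.Permutation.Setoid.Properties as ↭ₛ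
open import Data.Product using (Σ-syntax; ∃-syntax; _×_; _,_; proj₁; proj₂; swap)
open import Data.Sum using (_⊎_; inj₁; inj₂; [_,_]′)
import Data.Vec as Vec
import Data.Vec.Properties as Vec
open import Data.Vec.Functional as Vector using (Vector; updateAt)
open import Data.Vec.Functional.Properties using (updateAt-updates; updateAt-minimal)
open import Algebra.Bundles using (Group)
import Algebra.Properties.AbelianGroup +-0-abelianGroup as ℤ+
import Algebra.Properties.Group as GroupProperties
open import Function using (_∘_; id; const; mk⇔)
open import Function.Definitions using (Injective; Surjective)
open import Relation.Binary using (IsDecEquivalence)
open import Relation.Binary.PropositionalEquality hiding ([_])
open import Relation.Nullary using (¬_; yes; no; contradiction)
open import Relation.Unary using (Pred; Decidable)
open import Relation.Unary.Properties using (∁?)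

open import Defs

private
  variable
    A X Y : Set
    a b d e : ℕ
    f g p r : ℤ → ℤ

-- Polynomial functions

-- f is a polynomial function with at most d coefficients (degree < d), in Horner form.
data Poly< : ℕ → (ℤ → ℤ) → Set where
  vanishing : ∀ {f} → (∀ x → f x ≡ 0ℤ) → Poly< 0 f
  horner    : ∀ {d f} c {g} → Poly< d g → (∀ x → f x ≡ c + x * g x) → Poly< (suc d) f

Poly<-resp-≗ : Poly< d f → f ≗ g → Poly< d g
Poly<-resp-≗ (vanishing f≗0)   f≗g = vanishing (λ x → trans (sym (f≗g x)) (f≗0 x))
Poly<-resp-≗ (horner c pg f≡) f≗g = horner c pg (λ x → trans (sym (f≗g x)) (f≡ x))

Poly<-0 : ∀ d → Poly< d (const 0ℤ)
Poly<-0 zero    = vanishing (λ _ → refl)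
Poly<-0 (suc d) = horner 0ℤ (Poly<-0 d) (λ x → sym (trans (+-identityˡ _) (*-zeroʳ x)))

c+x*0≡c : ∀ c x → c + x * 0ℤ ≡ c
c+x*0≡c c x = trans (cong (_+_ c) (*-zeroʳ x)) (+-identityʳ c)

Poly<-const : ∀ c → Poly< 1 (const c)
Poly<-const c = horner c (Poly<-0 0) (λ x → sym (c+x*0≡c c x))

horner-constant : ∀ {c} {g : ℤ → ℤ} → (∀ x → g x ≡ 0ℤ) → (∀ x → f x ≡ c + x * g x) → ∀ x → f x ≡ c
horner-constant {c = c} g≗0 f≡ x = trans (f≡ x) (trans (cong (λ z → c + x * z) (g≗0 x)) (c+x*0≡c c x))

Poly<-weaken : d ≤ e → Poly< d f → Poly< e f
Poly<-weaken {e = e} z≤n (vanishing f≗0) = Poly<-resp-≗ (Poly<-0 e) (λ x → sym (f≗0 x))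
Poly<-weaken (s≤s d≤e) (horner c pg f≡) = horner c (Poly<-weaken d≤e pg) f≡

Poly<-+ : Poly< d f → Poly< d g → Poly< d (λ x → f x + g x)
Poly<-+ (vanishing f≗0) (vanishing g≗0) = vanishing (λ x → cong₂ _+_ (f≗0 x) (g≗0 x))
Poly<-+ (horner c pf f≡) (horner c′ pg g≡) =
  horner (c + c′) (Poly<-+ pf pg) (λ x → trans (cong₂ _+_ (f≡ x) (g≡ x)) (regroup c c′ x _ _))
  where
  regroup : ∀ c c′ x u v → (c + x * u) + (c′ + x * v) ≡ (c + c′) + x * (u + v)
  regroup = solve-∀

Poly<-*ˡ : ∀ k → Poly< d f → Poly< d (λ x → k * f x)
Poly<-*ˡ k (vanishing f≗0) = vanishing (λ x → trans (cong (k *_) (f≗0 x)) (*-zeroʳ k))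
Poly<-*ˡ k (horner c pg f≡) =
  horner (k * c) (Poly<-*ˡ k pg) (λ x → trans (cong (k *_) (f≡ x)) (distrib k c x _))
  where
  distrib : ∀ k c x u → k * (c + x * u) ≡ k * c + x * (k * u)
  distrib = solve-∀

Poly<-neg : Poly< d f → Poly< d (λ x → - f x)
Poly<-neg pf = Poly<-resp-≗ (Poly<-*ˡ (- 1ℤ) pf) (λ x → -1*i≡-i _)

Poly<-- : Poly< d f → Poly< d g → Poly< d (λ x → f x - g x)
Poly<-- pf pg = Poly<-+ pf (Poly<-neg pg)

Poly<-x* : Poly< d f → Poly< (suc d) (λ x → x * f x)
Poly<-x* pf = horner 0ℤ pf (λ x → sym (+-identityˡ _))

Poly<-x^* : ∀ k → Poly< d f → Poly< (k ℕ.+ d) (λ x → x ^ k * f x)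
Poly<-x^* zero    pf = Poly<-resp-≗ pf (λ x → sym (*-identityˡ _))
Poly<-x^* (suc k) pf = Poly<-resp-≗ (Poly<-x* (Poly<-x^* k pf)) (λ x → sym (*-assoc x _ _))

Poly<-* : Poly< (suc a) f → Poly< (suc b) g → Poly< (suc (a ℕ.+ b)) (λ x → f x * g x)
Poly<-* {a = zero} {g = g} (horner c (vanishing f′≗0) f≡) pg =
  Poly<-resp-≗ (Poly<-*ˡ c pg) (λ x → cong (_* g x) (sym (horner-constant {c = c} f′≗0 f≡ x)))
Poly<-* {a = suc a} {b = b} (horner c pf′ f≡) pg =
  Poly<-resp-≗ (Poly<-+ (Poly<-weaken (s≤s (ℕ.m≤n+m b (suc a))) (Poly<-*ˡ c pg))
                        (Poly<-x* (Poly<-* pf′ pg)))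
               (λ x → sym (trans (cong (_* _) (f≡ x)) (distrib c x _ _)))
  where
  distrib : ∀ c x u v → (c + x * u) * v ≡ c * v + x * (u * v)
  distrib = solve-∀

Poly<-*′ : Poly< a f → Poly< b g → Poly< (a ℕ.+ b) (λ x → f x * g x)
Poly<-*′ {b = b} {g = g} (vanishing f≗0) pg =
  Poly<-resp-≗ (Poly<-0 b) (λ x → sym (trans (cong (_* g x) (f≗0 x)) (*-zeroˡ (g x))))
Poly<-*′ {a = suc a} {f = f} pf (vanishing g≗0) =
  Poly<-resp-≗ (Poly<-0 _) (λ x → sym (trans (cong (f x *_) (g≗0 x)) (*-zeroʳ (f x))))
Poly<-*′ {a = suc a} {b = suc b} pf pg = Poly<-weaken (s≤s (ℕ.+-monoʳ-≤ a (ℕ.n≤1+n b))) (Poly<-* pf pg)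

Poly<-∑ : ∀ n {F : ℤ → Fin n → ℤ} → (∀ j → Poly< d (λ x → F x j)) → Poly< d (λ x → ∑ n (F x))
Poly<-∑ {d} zero    pF = Poly<-0 d
Poly<-∑     (suc n) pF = Poly<-+ (pF zero) (Poly<-∑ n (pF ∘ suc))

data Monic (d : ℕ) (f : ℤ → ℤ) : Set where
  x^d+ : ∀ {r} → Poly< d r → (∀ x → f x ≡ x ^ d + r x) → Monic d f

Monic-resp-≗ : Monic d f → f ≗ g → Monic d g
Monic-resp-≗ (x^d+ pr f≡) f≗g = x^d+ pr (λ x → trans (sym (f≗g x)) (f≡ x))

Monic-0⇒≡1 : Monic 0 f → ∀ x → f x ≡ 1ℤ
Monic-0⇒≡1 (x^d+ (vanishing r≗0) f≡) x = trans (f≡ x) (cong (_+_ 1ℤ) (r≗0 x))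

x^-monic : ∀ d → Monic d (_^ d)
x^-monic d = x^d+ (Poly<-0 d) (λ x → sym (+-identityʳ _))

x-μ-monic : ∀ μ → Monic 1 (λ x → x - μ)
x-μ-monic μ = x^d+ (Poly<-const (- μ)) (λ x → cong (_- μ) (sym (*-identityʳ x)))

Monic-+ : Monic d f → Poly< d g → Monic d (λ x → f x + g x)
Monic-+ {d} {g = g} (x^d+ {r} pr f≡) pg =
  x^d+ (Poly<-+ pr pg) (λ x → trans (cong (_+ g x) (f≡ x)) (+-assoc (x ^ d) (r x) (g x)))

Monic-- : Monic d f → Monic d g → Poly< d (λ x → f x - g x)
Monic-- {d} (x^d+ {r} pr f≡) (x^d+ {s} ps g≡) =
  Poly<-resp-≗ (Poly<-- pr ps) (λ x → sym (trans (cong₂ _-_ (f≡ x) (g≡ x)) (cancel (x ^ d) (r x) (s x))))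
  where
  cancel : ∀ X u v → (X + u) - (X + v) ≡ u - v
  cancel = solve-∀

Monic-* : Monic a f → Monic b g → Monic (a ℕ.+ b) (λ x → f x * g x)
Monic-* {a} {b = b} (x^d+ {r} pr f≡) (x^d+ {s} ps g≡) =
  x^d+ (Poly<-+ (Poly<-+ (Poly<-x^* a ps) (subst (λ d → Poly< d (λ x → x ^ b * r x)) (ℕ.+-comm b a) (Poly<-x^* b pr)))
                (Poly<-*′ pr ps))
       (λ x → trans (cong₂ _*_ (f≡ x) (g≡ x))
                    (trans (expand (x ^ a) (x ^ b) (r x) (s x))
                           (cong (_+ ((x ^ a * s x + x ^ b * r x) + r x * s x)) (sym (^-distribˡ-+-* x a b)))))
  where
  expand : ∀ A B u v → (A + u) * (B + v) ≡ A * B + ((A * v + B * u) + u * v)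
  expand = solve-∀

Monic-^ : ∀ k → Monic a f → Monic (k ℕ.* a) (λ x → f x ^ k)
Monic-^ zero    mf = x^d+ (Poly<-0 0) (λ _ → refl)
Monic-^ (suc k) mf = Monic-* mf (Monic-^ k mf)

∏-monic : ∀ n (μ : Vector ℤ n) → Monic n (λ x → ∏ n (λ i → x - μ i))
∏-monic zero    μ = x^d+ (Poly<-0 0) (λ _ → refl)
∏-monic (suc n) μ = Monic-* (x-μ-monic (μ zero)) (∏-monic n (μ ∘ suc))

-- Roots

Poly<-factor : Poly< (suc d) f → ∀ μ → Σ[ q ∈ (ℤ → ℤ) ] Poly< d q × (∀ x → f x - f μ ≡ (x - μ) * q x)
Poly<-factor (horner c (vanishing g≗0) f≡) μ =
  const 0ℤ , vanishing (λ _ → refl) ,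
  λ x → trans (cong₂ _-_ (horner-constant {c = c} g≗0 f≡ x) (horner-constant {c = c} g≗0 f≡ μ))
              (trans (+-inverseʳ c) (sym (*-zeroʳ (x - μ))))
Poly<-factor {f = f} (horner c {g} pg@(horner _ _ _) f≡) μ =
  let q , pq , g≡ = Poly<-factor pg μ in
  (λ x → g x + μ * q x) , Poly<-+ pg (Poly<-weaken (ℕ.n≤1+n _) (Poly<-*ˡ μ pq)) ,
  λ x → begin
    f x - f μ                                 ≡⟨ cong₂ _-_ (f≡ x) (f≡ μ) ⟩
    (c + x * g x) - (c + μ * g μ)             ≡⟨ split c x μ (g x) (g μ) ⟩
    (x - μ) * g x + μ * (g x - g μ)           ≡⟨ cong (λ z → (x - μ) * g x + μ * z) (g≡ x) ⟩
    (x - μ) * g x + μ * ((x - μ) * q x)       ≡⟨ collect x μ (g x) (q x) ⟩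
    (x - μ) * (g x + μ * q x)                 ∎
  where
  open ≡-Reasoning
  split : ∀ c x μ u v → (c + x * u) - (c + μ * v) ≡ (x - μ) * u + μ * (u - v)
  split = solve-∀
  collect : ∀ x μ u v → (x - μ) * u + μ * ((x - μ) * v) ≡ (x - μ) * (u + μ * v)
  collect = solve-∀

x^-factor : ∀ d μ → Σ[ h ∈ (ℤ → ℤ) ] Monic d h × (∀ x → x ^ suc d - μ ^ suc d ≡ (x - μ) * h x)
x^-factor zero    μ = const 1ℤ , x^-monic 0 , λ x → step x μ
  where
  step : ∀ x μ → x * 1ℤ - μ * 1ℤ ≡ (x - μ) * 1ℤ
  step = solve-∀
x^-factor (suc d) μ with x^-factor d μ
... | h , x^d+ {r} pr h≡ , h-factor =
  (λ x → x * h x + μ ^ suc d) ,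
  x^d+ (horner (μ ^ suc d) pr (λ _ → refl))
       (λ x → trans (cong (λ z → x * z + μ ^ suc d) (h≡ x)) (regroup x (x ^ d) (r x) (μ ^ suc d))) ,
  λ x → trans (peel x μ (x ^ suc d) (μ ^ suc d))
              (trans (cong (λ z → x * z + (x - μ) * μ ^ suc d) (h-factor x)) (collect x μ (h x) (μ ^ suc d)))
  where
  regroup : ∀ x X u M → x * (X + u) + M ≡ x * X + (M + x * u)
  regroup = solve-∀
  peel : ∀ x μ X M → x * X - μ * M ≡ x * (X - M) + (x - μ) * M
  peel = solve-∀
  collect : ∀ x μ u M → x * ((x - μ) * u) + (x - μ) * M ≡ (x - μ) * (x * u + M)
  collect = solve-∀

Monic-factor : Monic (suc d) f → ∀ μ → f μ ≡ 0ℤ →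
               Σ[ q ∈ (ℤ → ℤ) ] Monic d q × (∀ x → f x ≡ (x - μ) * q x)
Monic-factor {d} {f} (x^d+ {r} pr f≡) μ fμ≡0 =
  let h , mh , h-factor = x^-factor d μ
      q , pq , r-factor = Poly<-factor pr μ
  in (λ x → h x + q x) , Monic-+ mh pq , λ x → begin
    f x                                          ≡⟨ sym (trans (cong (_-_ (f x)) fμ≡0) (+-identityʳ (f x))) ⟩
    f x - f μ                                    ≡⟨ cong₂ _-_ (f≡ x) (f≡ μ) ⟩
    (x ^ suc d + r x) - (μ ^ suc d + r μ)        ≡⟨ regroup (x ^ suc d) (μ ^ suc d) (r x) (r μ) ⟩
    (x ^ suc d - μ ^ suc d) + (r x - r μ)        ≡⟨ cong₂ _+_ (h-factor x) (r-factor x) ⟩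
    (x - μ) * h x + (x - μ) * q x                ≡⟨ sym (*-distribˡ-+ (x - μ) (h x) (q x)) ⟩
    (x - μ) * (h x + q x)                        ∎
  where
  open ≡-Reasoning
  regroup : ∀ X M u v → (X + u) - (M + v) ≡ (X - M) + (u - v)
  regroup = solve-∀

sumAbs : List ℤ → ℕ
sumAbs []      = 0
sumAbs (e ∷ E) = ∣ e ∣ ℕ.+ sumAbs E

∈⇒∣∣≤sumAbs : ∀ {e} E → e ∈ E → ∣ e ∣ ≤ sumAbs E
∈⇒∣∣≤sumAbs (e ∷ E) (here refl) = ℕ.m≤m+n ∣ e ∣ (sumAbs E)
∈⇒∣∣≤sumAbs (e ∷ E) (there e∈) = ℕ.≤-trans (∈⇒∣∣≤sumAbs E e∈) (ℕ.m≤n+m (sumAbs E) ∣ e ∣)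

multiple-∉ : ∀ c .{{_ : ℕ.NonZero c}} (E : List ℤ) → ∃[ y ] + c * y ∉ E
multiple-∉ c E = + suc S , λ cy∈E →
  ℕ.<-irrefl refl (ℕ.≤-trans (ℕ.m≤n*m (suc S) c) (∈⇒∣∣≤sumAbs E (subst (_∈ E) (sym (pos-* c (suc S))) cy∈E)))
  where
  S : ℕ
  S = sumAbs E

InfinitelyManyRoots : (ℤ → ℤ) → Set
InfinitelyManyRoots h = ∀ (E : List ℤ) → ∃[ a ] a ∉ E × h a ≡ 0ℤ

fresh : (E : List ℤ) → ∃[ y ] y ∉ E
fresh E with multiple-∉ 1 E
... | y , 1*y∉E = + 1 * y , 1*y∉E

Poly<-identity : Poly< d f → InfinitelyManyRoots f → ∀ x → f x ≡ 0ℤ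
Poly<-identity (vanishing f≗0) _ = f≗0
Poly<-identity {f = f} pf@(horner _ _ _) roots x with roots []
... | μ , _ , fμ≡0 =
  let q , pq , f-factor = Poly<-factor pf μ
  in begin
    f x                    ≡⟨ sym (trans (cong (_-_ (f x)) fμ≡0) (+-identityʳ (f x))) ⟩
    f x - f μ              ≡⟨ f-factor x ⟩
    (x - μ) * q x          ≡⟨ cong ((x - μ) *_) (Poly<-identity pq (q-roots q f-factor) x) ⟩
    (x - μ) * 0ℤ           ≡⟨ *-zeroʳ (x - μ) ⟩
    0ℤ                     ∎
  where
  open ≡-Reasoning
  q-roots : ∀ q → (∀ x → f x - f μ ≡ (x - μ) * q x) → InfinitelyManyRoots q
  q-roots q f-factor E with roots (μ ∷ E)
  ... | y , y∉μ∷E , fy≡0 with i*j≡0⇒i≡0∨j≡0 (y - μ) (trans (sym (f-factor y)) (cong₂ _-_ fy≡0 fμ≡0))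
  ...   | inj₁ y-μ≡0 = contradiction (here (i-j≡0⇒i≡j y μ y-μ≡0)) y∉μ∷E
  ...   | inj₂ qy≡0  = y , (λ y∈E → y∉μ∷E (there y∈E)) , qy≡0

Poly<-cancel : ∀ μ → Poly< d (λ x → f x - g x) → (∀ x → (x - μ) * f x ≡ (x - μ) * g x) → ∀ x → f x ≡ g x
Poly<-cancel {f = f} {g = g} μ pf-g μ-factor x = i-j≡0⇒i≡j (f x) (g x) (Poly<-identity pf-g roots x)
  where
  roots : InfinitelyManyRoots (λ x → f x - g x)
  roots E with fresh (μ ∷ E)
  ... | y , y∉μ∷E = y , (λ y∈E → y∉μ∷E (there y∈E)) , i≡j⇒i-j≡0 fy≡gy
    where
    instance
      y-μ≢0 : NonZero (y - μ)
      y-μ≢0 = ≢-nonZero (λ y-μ≡0 → y∉μ∷E (here (i-j≡0⇒i≡j y μ y-μ≡0)))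
    fy≡gy : f y ≡ g y
    fy≡gy = *-cancelˡ-≡ (y - μ) (f y) (g y) (μ-factor y)

Splits : ℕ → (ℤ → ℤ) → Set
Splits n p = Σ[ λs ∈ Vector ℤ n ] (∀ x → p x ≡ ∏ n (λ i → x - λs i))

-- The root μ₀ of the product is a root of p or of r: divide it out of that factor and recurse.
monicFactors-split : ∀ n (μ : Vector ℤ n) → a ℕ.+ b ≡ n → Monic a p → Monic b r →
                     (∀ x → p x * r x ≡ ∏ n (λ i → x - μ i)) → Splits a p × Splits b r
monicFactors-split {zero} {zero} zero μ refl mp mr _ = ((λ ()) , Monic-0⇒≡1 mp) , ((λ ()) , Monic-0⇒≡1 mr)
monicFactors-split {a} {b} {p} {r} (suc n) μ a+b≡ mp mr pr≡∏ =
  [ peel a+b≡ mp mr pr≡∏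
  , (λ rμ₀≡0 → swap (peel (trans (ℕ.+-comm b a) a+b≡) mr mp (λ x → trans (*-comm (r x) (p x)) (pr≡∏ x)) rμ₀≡0))
  ]′ (i*j≡0⇒i≡0∨j≡0 (p (μ zero)) pr[μ₀]≡0)
  where
  pr[μ₀]≡0 : p (μ zero) * r (μ zero) ≡ 0ℤ
  pr[μ₀]≡0 = trans (pr≡∏ (μ zero)) (cong (_* ∏ n (λ i → μ zero - μ (suc i))) (+-inverseʳ (μ zero)))
  peel : ∀ {a b p r} → a ℕ.+ b ≡ suc n → Monic a p → Monic b r →
         (∀ x → p x * r x ≡ ∏ (suc n) (λ i → x - μ i)) → p (μ zero) ≡ 0ℤ → Splits a p × Splits b r
  peel {zero} _ mp _ _ pμ₀≡0 = contradiction (trans (sym (Monic-0⇒≡1 mp (μ zero))) pμ₀≡0) λ ()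
  peel {suc a} {b} {p} {r} a+b≡ mp mr pr≡∏ pμ₀≡0 =
    let q , mq , p-factor = Monic-factor mp (μ zero) pμ₀≡0
        (λs , q≡∏) , r-splits = monicFactors-split n (μ ∘ suc) (ℕ.suc-injective a+b≡) mq mr (quotient≡∏ mq p-factor)
    in ((μ zero Vector.∷ λs) , λ x → trans (p-factor x) (cong ((x - μ zero) *_) (q≡∏ x))) , r-splits
    where
    quotient≡∏ : ∀ {q} → Monic a q → (∀ x → p x ≡ (x - μ zero) * q x) →
                 ∀ x → q x * r x ≡ ∏ n (λ i → x - μ (suc i))
    quotient≡∏ {q} mq p-factor =
      Poly<-cancel (μ zero) (Monic-- (subst (λ d → Monic d (λ x → q x * r x)) (ℕ.suc-injective a+b≡) (Monic-* mq mr))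
                                     (∏-monic n (μ ∘ suc)))
                            (λ x → trans (sym (*-assoc (x - μ zero) (q x) (r x)))
                                         (trans (cong (_* r x) (sym (p-factor x))) (pr≡∏ x)))

∏-cong : ∀ n {f g : Fin n → ℤ} → f ≗ g → ∏ n f ≡ ∏ n g
∏-cong zero    f≗g = refl
∏-cong (suc n) f≗g = cong₂ _*_ (f≗g zero) (∏-cong n (f≗g ∘ suc))

∏-*ˡ : ∀ n c (f : Fin n → ℤ) → ∏ n (λ i → c * f i) ≡ c ^ n * ∏ n f
∏-*ˡ zero    c f = refl
∏-*ˡ (suc n) c f = trans (cong (c * f zero *_) (∏-*ˡ n c (f ∘ suc))) (regroup c (f zero) (c ^ n) (∏ n (f ∘ suc)))
  where
  regroup : ∀ c a C P → c * a * (C * P) ≡ c * C * (a * P)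
  regroup = solve-∀

∏[x-λ]-root : ∀ n (λs : Vector ℤ n) i → ∏ n (λ j → λs i - λs j) ≡ 0ℤ
∏[x-λ]-root (suc n) λs zero    = cong (_* ∏ n (λ j → λs zero - λs (suc j))) (+-inverseʳ (λs zero))
∏[x-λ]-root (suc n) λs (suc i) =
  trans (cong ((λs (suc i) - λs zero) *_) (∏[x-λ]-root n (λs ∘ suc) i)) (*-zeroʳ (λs (suc i) - λs zero))

-- Rational roots

^-distribʳ-* : ∀ i j n → (i * j) ^ n ≡ i ^ n * j ^ n
^-distribʳ-* i j zero    = refl
^-distribʳ-* i j (suc n) = trans (cong ((i * j) *_) (^-distribʳ-* i j n)) (swap-middle i j (i ^ n) (j ^ n))
  where
  swap-middle : ∀ i j u v → (i * j) * (u * v) ≡ (i * u) * (j * v)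
  swap-middle = solve-∀

abs-^ : ∀ i n → ∣ i ^ n ∣ ≡ ∣ i ∣ ℕ.^ n
abs-^ i zero    = refl
abs-^ i (suc n) = trans (abs-* i (i ^ n)) (cong (∣ i ∣ ℕ.*_) (abs-^ i n))

coprime-∣^⇒∣1 : ∀ {v u} k → Coprime v u → v ℕ.∣ u ℕ.^ k → v ℕ.∣ 1
coprime-∣^⇒∣1 zero    _      v∣1     = v∣1
coprime-∣^⇒∣1 (suc k) cop[v,u] v∣u^k+1 = coprime-∣^⇒∣1 k cop[v,u] (coprime-divisor cop[v,u] v∣u^k+1)

lowestTerms : ∀ ν c .{{_ : ℕ.NonZero c}} →
              ∃[ g ] ∃[ u ] ∃[ v ] ℕ.NonZero g × ν ≡ + g * u × c ≡ v ℕ.* g × Coprime ∣ u ∣ v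
lowestTerms ν c = gcd[ν,c] , u , v , gcd≢0 , ν≡gcd*u , equality c-divides , coprime[u,v]
  where
  open ℕ._∣_ using (quotient; equality)
  gcd[ν,c] : ℕ
  gcd[ν,c] = gcd ∣ ν ∣ c
  instance
    gcd≢0 : ℕ.NonZero gcd[ν,c]
    gcd≢0 = ℕ.≢-nonZero (gcd[m,n]≢0 ∣ ν ∣ c (inj₂ (ℕ.≢-nonZero⁻¹ c)))
  ν-divides : gcd[ν,c] ℕ.∣ ∣ ν ∣
  ν-divides = gcd[m,n]∣m ∣ ν ∣ c
  c-divides : gcd[ν,c] ℕ.∣ c
  c-divides = gcd[m,n]∣n ∣ ν ∣ c
  u : ℤ
  u = ℤ.sign ν ◃ quotient ν-divides
  v : ℕ
  v = quotient c-divides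
  ν≡gcd*u : ν ≡ + gcd[ν,c] * u
  ν≡gcd*u = begin
    ν
      ≡⟨ sym (◃-inverse ν) ⟩
    ℤ.sign ν ◃ ∣ ν ∣
      ≡⟨ cong₂ _◃_ (sym (Sign.*-identityʳ (ℤ.sign ν))) (equality ν-divides) ⟩
    (ℤ.sign ν Sign.* Sign.+) ◃ (quotient ν-divides ℕ.* gcd[ν,c])
      ≡⟨ ◃-distrib-* (ℤ.sign ν) Sign.+ (quotient ν-divides) gcd[ν,c] ⟩
    u * (Sign.+ ◃ gcd[ν,c])
      ≡⟨ cong (u *_) (+◃n≡+n gcd[ν,c]) ⟩
    u * + gcd[ν,c]
      ≡⟨ *-comm u (+ gcd[ν,c]) ⟩
    + gcd[ν,c] * u ∎
    where open ≡-Reasoning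
  coprime[u,v] : Coprime ∣ u ∣ v
  coprime[u,v] =
    subst₂ Coprime (trans (cong (_/ gcd[ν,c]) (equality ν-divides))
                          (trans (m*n/n≡m (quotient ν-divides) gcd[ν,c]) (sym (abs-◃ (ℤ.sign ν) (quotient ν-divides)))))
                   (trans (cong (_/ gcd[ν,c]) (equality c-divides)) (m*n/n≡m v gcd[ν,c]))
                   (coprime-/gcd ∣ ν ∣ c)

-- With ν / c = u / v in lowest terms, homogeneity gives Q u v = 0, hence v ∣ u ^ k, so v = 1.
homogeneousRoot-divisible :
  ∀ k (Q : ℤ → ℤ → ℤ) → (∀ t u v → Q (t * u) (t * v) ≡ t ^ k * Q u v) →
  (∀ u v → ∃[ T ] Q u v ≡ u ^ k + v * T) →
  ∀ ν c .{{_ : ℕ.NonZero c}} → Q ν (+ c) ≡ 0ℤ → ∃[ t ] ν ≡ + c * t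
homogeneousRoot-divisible k Q Q-homogeneous Q-monic ν c Q[ν,c]≡0 with lowestTerms ν c
... | g , u , v , g≢0 , ν≡g*u , c≡v*g , coprime[u,v] = u , trans ν≡g*u (cong (_* u) (sym c≡g))
  where
  c≡g*v : + c ≡ + g * + v
  c≡g*v = trans (cong +_ c≡v*g) (trans (pos-* v g) (*-comm (+ v) (+ g)))
  Q[u,v]≡0 : Q u (+ v) ≡ 0ℤ
  Q[u,v]≡0 = [ (λ g^k≡0 → contradiction (i^n≡0⇒i≡0 (+ g) k g^k≡0) (ℕ.≢-nonZero⁻¹ g {{g≢0}} ∘ +-injective))
             , id
             ]′
                (i*j≡0⇒i≡0∨j≡0 ((+ g) ^ k) (trans (sym (Q-homogeneous (+ g) u (+ v)))
                                                 (trans (sym (cong₂ Q ν≡g*u c≡g*v)) Q[ν,c]≡0)))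
  v≡1 : v ≡ 1
  v≡1 with Q-monic u (+ v)
  ... | T , Q≡ = ∣1⇒≡1 (coprime-∣^⇒∣1 k (Coprime.sym coprime[u,v]) (divides ∣ T ∣ ∣u∣^k≡∣T∣*v))
    where
    ∣u∣^k≡∣T∣*v : ∣ u ∣ ℕ.^ k ≡ ∣ T ∣ ℕ.* v
    ∣u∣^k≡∣T∣*v = begin
      ∣ u ∣ ℕ.^ k        ≡⟨ sym (abs-^ u k) ⟩
      ∣ u ^ k ∣          ≡⟨ cong ∣_∣ (ℤ+.inverseˡ-unique (u ^ k) (+ v * T) (trans (sym Q≡) Q[u,v]≡0)) ⟩
      ∣ - (+ v * T) ∣    ≡⟨ ∣-i∣≡∣i∣ (+ v * T) ⟩
      ∣ + v * T ∣        ≡⟨ abs-* (+ v) T ⟩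
      v ℕ.* ∣ T ∣        ≡⟨ ℕ.*-comm v ∣ T ∣ ⟩
      ∣ T ∣ ℕ.* v        ∎
      where open ≡-Reasoning
  c≡g : + c ≡ + g
  c≡g = trans c≡g*v (trans (cong (λ v → + g * + v) v≡1) (*-identityʳ (+ g)))

-- homogenize {d} r u v = v ^ d * r (u / v).
homogenize : Poly< d r → ℤ → ℤ → ℤ
homogenize (vanishing _)        u v = 0ℤ
homogenize (horner {d} c pg _) u v = c * v ^ suc d + u * homogenize pg u v

homogenize-at-1 : (pr : Poly< d r) → ∀ u → homogenize pr u 1ℤ ≡ r u
homogenize-at-1 (vanishing r≗0)             u = sym (r≗0 u)
homogenize-at-1 {r = r} (horner {d} c {g} pg r≡) u = begin
  c * 1ℤ ^ suc d + u * homogenize pg u 1ℤ ≡⟨ cong₂ (λ z w → c * z + u * w) (^-zeroˡ (suc d)) (homogenize-at-1 pg u) ⟩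
  c * 1ℤ + u * g u                        ≡⟨ cong (_+ u * g u) (*-identityʳ c) ⟩
  c + u * g u                             ≡⟨ sym (r≡ u) ⟩
  r u                                     ∎
  where open ≡-Reasoning

homogenize-homogeneous : (pr : Poly< d r) → ∀ t u v →
                         homogenize pr (t * u) (t * v) ≡ t ^ d * homogenize pr u v
homogenize-homogeneous (vanishing _)        t u v = sym (*-zeroʳ (t ^ 0))
homogenize-homogeneous (horner {d} c pg _) t u v =
  trans (cong₂ (λ z w → c * z + (t * u) * w) (^-distribʳ-* t v (suc d)) (homogenize-homogeneous pg t u v))
        (factor-out c t (t ^ d) (v ^ suc d) u (homogenize pg u v))
  where
  factor-out : ∀ c t T V u h → c * ((t * T) * V) + (t * u) * (T * h) ≡ (t * T) * (c * V + u * h)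
  factor-out = solve-∀

homogenize-divisible : (pr : Poly< d r) → ∀ u v → ∃[ T ] homogenize pr u v ≡ v * T
homogenize-divisible (vanishing _)        u v = 0ℤ , sym (*-zeroʳ v)
homogenize-divisible (horner {d} c pg _) u v with homogenize-divisible pg u v
... | T , H≡v*T = c * v ^ d + u * T , trans (cong (λ z → c * v ^ suc d + u * z) H≡v*T) (factor-out c v (v ^ d) u T)
  where
  factor-out : ∀ c v V u T → c * (v * V) + u * (v * T) ≡ v * (c * V + u * T)
  factor-out = solve-∀

homogenize-poly : (pr : Poly< d r) → ∀ v → Poly< d (λ u → homogenize pr u v)
homogenize-poly (vanishing _)        v = vanishing (λ _ → refl)
homogenize-poly (horner {d} c pg _) v = horner (c * v ^ suc d) (homogenize-poly pg v) (λ _ → refl)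

-- E x = c ^ k * p (x / c), so ν / c is a rational root of the monic p, hence an integer.
monicRoot-divisible : ∀ {k p E} c .{{_ : ℕ.NonZero c}} → Monic k p → Monic k E →
                      (∀ y → E (+ c * y) ≡ (+ c) ^ k * p y) → ∀ ν → E ν ≡ 0ℤ → ∃[ t ] ν ≡ + c * t
monicRoot-divisible {k} {p} {E} c (x^d+ {r} pr p≡) mE E[cy]≡ ν Eν≡0 =
  homogeneousRoot-divisible k Q Q-homogeneous Q-monic ν c (trans (sym (E≗Q[_,c] ν)) Eν≡0)
  where
  Q : ℤ → ℤ → ℤ
  Q u v = u ^ k + homogenize pr u v
  Q-homogeneous : ∀ t u v → Q (t * u) (t * v) ≡ t ^ k * Q u v
  Q-homogeneous t u v = trans (cong₂ _+_ (^-distribʳ-* t u k) (homogenize-homogeneous pr t u v))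
                              (sym (*-distribˡ-+ (t ^ k) (u ^ k) (homogenize pr u v)))
  Q-monic : ∀ u v → ∃[ T ] Q u v ≡ u ^ k + v * T
  Q-monic u v = let T , H≡v*T = homogenize-divisible pr u v in T , cong (_+_ (u ^ k)) H≡v*T
  E[cy]≡Q : ∀ y → E (+ c * y) ≡ Q (+ c * y) (+ c)
  E[cy]≡Q y = begin
    E (+ c * y)                       ≡⟨ E[cy]≡ y ⟩
    (+ c) ^ k * p y                   ≡⟨ cong ((+ c) ^ k *_) (trans (p≡ y) (cong (_+_ (y ^ k)) (sym (homogenize-at-1 pr y)))) ⟩
    (+ c) ^ k * Q y 1ℤ                ≡⟨ sym (Q-homogeneous (+ c) y 1ℤ) ⟩
    Q (+ c * y) (+ c * 1ℤ)            ≡⟨ cong (Q (+ c * y)) (*-identityʳ (+ c)) ⟩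
    Q (+ c * y) (+ c)                 ∎
    where open ≡-Reasoning
  E≗Q[_,c] : ∀ x → E x ≡ Q x (+ c)
  E≗Q[_,c] x = i-j≡0⇒i≡j (E x) (Q x (+ c))
    (Poly<-identity (Monic-- mE (x^d+ (homogenize-poly pr (+ c)) (λ _ → refl)))
                    (λ L → let y , cy∉L = multiple-∉ c L in + c * y , cy∉L , i≡j⇒i-j≡0 (E[cy]≡Q y)) x)

Splits-unscale : ∀ {k p E} c .{{_ : ℕ.NonZero c}} → Monic k p → Monic k E →
                 (∀ y → E (+ c * y) ≡ (+ c) ^ k * p y) → Splits k E → Splits k p
Splits-unscale {k} {p} {E} c mp mE E[cy]≡ (ν , E≡∏) = t , p≡∏
  where
  divisible : ∀ i → ∃[ t ] ν i ≡ + c * t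
  divisible i = monicRoot-divisible c mp mE E[cy]≡ (ν i) (trans (E≡∏ (ν i)) (∏[x-λ]-root k ν i))
  t : Vector ℤ k
  t i = proj₁ (divisible i)
  instance
    c^k≢0 : NonZero ((+ c) ^ k)
    c^k≢0 = ≢-nonZero (λ c^k≡0 → ℕ.≢-nonZero⁻¹ c (+-injective (i^n≡0⇒i≡0 (+ c) k c^k≡0)))
  p≡∏ : ∀ y → p y ≡ ∏ k (λ i → y - t i)
  p≡∏ y = *-cancelˡ-≡ ((+ c) ^ k) (p y) (∏ k (λ i → y - t i)) (begin
    (+ c) ^ k * p y                     ≡⟨ sym (E[cy]≡ y) ⟩
    E (+ c * y)                         ≡⟨ E≡∏ (+ c * y) ⟩
    ∏ k (λ i → + c * y - ν i)           ≡⟨ ∏-cong k (λ i → trans (cong (λ z → + c * y - z) (proj₂ (divisible i)))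
                                                                (*-distribˡ-- (+ c) y (t i))) ⟩
    ∏ k (λ i → + c * (y - t i))         ≡⟨ ∏-*ˡ k (+ c) (λ i → y - t i) ⟩
    (+ c) ^ k * ∏ k (λ i → y - t i)     ∎)
    where
    open ≡-Reasoning
    *-distribˡ-- : ∀ c y t → c * y - c * t ≡ c * (y - t)
    *-distribˡ-- = solve-∀

-- Determinants of submatrices

-- laplace g [c₀, …, cₖ] = Σⱼ (-1)ʲ g cⱼ (the list with cⱼ removed)
laplace : (Y → List Y → ℤ) → List Y → ℤ
laplace g []       = 0ℤ
laplace g (c ∷ cs) = g c cs - laplace (λ c′ l → g c′ (c ∷ l)) cs

-- The determinant of the submatrix of M on rows rs and columns cs, expanded along
-- its first row; it is 0 unless rs and cs have equal length.
minor : (X → Y → ℤ) → List X → List Y → ℤ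
minor M []       []      = 1ℤ
minor M []       (_ ∷ _) = 0ℤ
minor M (r ∷ rs) cs      = laplace (λ c l → M r c * minor M rs l) cs

laplace-cong : ∀ {g g′ : Y → List Y → ℤ} cs →
               (∀ {y l} → y ∈ cs → l ⊆ cs → suc (length l) ≡ length cs → g y l ≡ g′ y l) →
               laplace g cs ≡ laplace g′ cs
laplace-cong []       _     = refl
laplace-cong (c ∷ cs) g≡g′ =
  cong₂ _-_ (g≡g′ (here refl) there refl)
            (laplace-cong cs (λ y∈ l⊆ ∣l∣≡ → g≡g′ (there y∈) (λ { (here z≡c) → here z≡c ; (there z∈l) → there (l⊆ z∈l) })
                                                 (cong suc ∣l∣≡)))

laplace-+ : ∀ (g h : Y → List Y → ℤ) cs → laplace (λ y l → g y l + h y l) cs ≡ laplace g cs + laplace h cs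
laplace-+ g h []       = refl
laplace-+ g h (c ∷ cs) =
  trans (cong (_-_ (g c cs + h c cs)) (laplace-+ (λ c′ l → g c′ (c ∷ l)) (λ c′ l → h c′ (c ∷ l)) cs))
        (regroup (g c cs) (h c cs) _ _)
  where
  regroup : ∀ a b a′ b′ → (a + b) - (a′ + b′) ≡ (a - a′) + (b - b′)
  regroup = solve-∀

laplace-*ˡ : ∀ k (g : Y → List Y → ℤ) cs → laplace (λ y l → k * g y l) cs ≡ k * laplace g cs
laplace-*ˡ k g []       = sym (*-zeroʳ k)
laplace-*ˡ k g (c ∷ cs) =
  trans (cong (_-_ (k * g c cs)) (laplace-*ˡ k (λ c′ l → g c′ (c ∷ l)) cs)) (factor-out k (g c cs) _)
  where
  factor-out : ∀ k a b → k * a - k * b ≡ k * (a - b)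
  factor-out = solve-∀

laplace-neg : ∀ (g : Y → List Y → ℤ) cs → laplace (λ y l → - g y l) cs ≡ - laplace g cs
laplace-neg g cs = trans (laplace-cong cs (λ _ _ _ → sym (-1*i≡-i _))) (trans (laplace-*ˡ (- 1ℤ) g cs) (-1*i≡-i _))

laplace-zero : ∀ (g : Y → List Y → ℤ) cs → (∀ {y} l → y ∈ cs → g y l ≡ 0ℤ) → laplace g cs ≡ 0ℤ
laplace-zero g []       _     = refl
laplace-zero g (c ∷ cs) g≡0 =
  cong₂ _-_ (g≡0 cs (here refl)) (laplace-zero _ cs (λ l y∈ → g≡0 (c ∷ l) (there y∈)))

laplace-map : ∀ (h : A → Y) (g : Y → List Y → ℤ) cs → laplace g (map h cs) ≡ laplace (λ y l → g (h y) (map h l)) cs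
laplace-map h g []       = refl
laplace-map h g (c ∷ cs) = cong (_-_ (g (h c) (map h cs))) (laplace-map h (λ c′ l → g c′ (h c ∷ l)) cs)

laplace-++-zero : ∀ (g : Y → List Y → ℤ) cs ds → (∀ {y} l → y ∈ ds → g y l ≡ 0ℤ) →
                  laplace g (cs ++ ds) ≡ laplace (λ c l → g c (l ++ ds)) cs
laplace-++-zero g []       ds g≡0 = laplace-zero g ds g≡0
laplace-++-zero g (c ∷ cs) ds g≡0 =
  cong (_-_ (g c (cs ++ ds))) (laplace-++-zero (λ c′ l → g c′ (c ∷ l)) cs ds (λ l y∈ → g≡0 (c ∷ l) y∈))

∑-cong : ∀ n {f g : Fin n → ℤ} → f ≗ g → ∑ n f ≡ ∑ n g
∑-cong zero    f≗g = refl
∑-cong (suc n) f≗g = cong₂ _+_ (f≗g zero) (∑-cong n (f≗g ∘ suc))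

∑-neg : ∀ n (f : Fin n → ℤ) → ∑ n (λ i → - f i) ≡ - ∑ n f
∑-neg zero    f = refl
∑-neg (suc n) f = trans (cong (_+_ (- f zero)) (∑-neg n (f ∘ suc))) (sym (neg-distrib-+ (f zero) _))

laplace-tabulate : ∀ n (γ : Fin (suc n) → Y) (g : Y → List Y → ℤ) →
                   laplace g (tabulate γ) ≡ ∑ (suc n) (λ j → sign (toℕ j) * g (γ j) (tabulate (γ ∘ punchIn j)))
laplace-tabulate zero    γ g = cong (_+ 0ℤ) (sym (*-identityˡ (g (γ zero) [])))
laplace-tabulate (suc n) γ g =
  trans (cong (_-_ head) (laplace-tabulate n (γ ∘ suc) (λ c l → g c (γ zero ∷ l))))
        (cong₂ _+_ (sym (*-identityˡ head))
                   (trans (sym (∑-neg (suc n) (λ j → sign (toℕ j) * tail j)))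
                          (∑-cong (suc n) (λ j → neg-distribˡ-* (sign (toℕ j)) (tail j)))))
  where
  head : ℤ
  head = g (γ zero) (tabulate (γ ∘ suc))
  tail : Fin (suc n) → ℤ
  tail j = g (γ (suc j)) (γ zero ∷ tabulate (γ ∘ suc ∘ punchIn j))

minor-cong : ∀ {M M′ : X → Y → ℤ} rs cs → (∀ {r c} → r ∈ rs → c ∈ cs → M r c ≡ M′ r c) →
             minor M rs cs ≡ minor M′ rs cs
minor-cong []       []      _    = refl
minor-cong []       (_ ∷ _) _    = refl
minor-cong (r ∷ rs) cs      M≡M′ =
  laplace-cong cs (λ {_} {l} y∈ l⊆ _ →
    cong₂ _*_ (M≡M′ (here refl) y∈) (minor-cong rs l (λ r∈ c∈ → M≡M′ (there r∈) (l⊆ c∈))))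

minor-map : ∀ {B : Set} (M : X → Y → ℤ) (ρ : A → X) (γ : B → Y) rs cs →
            minor M (map ρ rs) (map γ cs) ≡ minor (λ r c → M (ρ r) (γ c)) rs cs
minor-map M ρ γ []       []      = refl
minor-map M ρ γ []       (_ ∷ _) = refl
minor-map M ρ γ (r ∷ rs) cs      =
  trans (laplace-map γ _ cs) (laplace-cong cs (λ {y} {l} _ _ _ → cong (M (ρ r) (γ y) *_) (minor-map M ρ γ rs l)))

det≡minor-tabulate : ∀ n (M : X → Y → ℤ) (ρ : Fin n → X) (γ : Fin n → Y) →
                     det n (λ i j → M (ρ i) (γ j)) ≡ minor M (tabulate ρ) (tabulate γ)
det≡minor-tabulate zero    M ρ γ = refl
det≡minor-tabulate (suc n) M ρ γ = sym (trans (laplace-tabulate n γ (λ c l → M (ρ zero) c * minor M (tabulate (ρ ∘ suc)) l))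
  (∑-cong (suc n) (λ j → cong (λ z → sign (toℕ j) * (M (ρ zero) (γ j) * z))
                              (sym (det≡minor-tabulate n M (ρ ∘ suc) (γ ∘ punchIn j))))))

det≡minor : ∀ n (M : Matrix n) → det n M ≡ minor M (allFin n) (allFin n)
det≡minor n M = det≡minor-tabulate n M id id

data AdjacentSwap {A : Set} : List A → List A → Set where
  here  : ∀ a b l → AdjacentSwap (a ∷ b ∷ l) (b ∷ a ∷ l)
  there : ∀ c {l l′} → AdjacentSwap l l′ → AdjacentSwap (c ∷ l) (c ∷ l′)

AdjacentSwap-++ˡ : ∀ (pre : List A) {l l′} → AdjacentSwap l l′ → AdjacentSwap (pre ++ l) (pre ++ l′)
AdjacentSwap-++ˡ []        s = s
AdjacentSwap-++ˡ (x ∷ pre) s = there x (AdjacentSwap-++ˡ pre s)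

↭-invariant : ∀ {B : Set} (f : List A → B) → (∀ {xs ys} → AdjacentSwap xs ys → f xs ≡ f ys) →
              ∀ {xs ys} → xs ↭ ys → f xs ≡ f ys
↭-invariant f f-swap xs↭ys = after [] xs↭ys
  where
  after : ∀ pre {xs ys} → xs ↭ ys → f (pre ++ xs) ≡ f (pre ++ ys)
  after pre ↭.refl                   = refl
  after pre (↭.prep {xs} {ys} x p)   =
    subst₂ (λ u v → f u ≡ f v) (++-assoc pre [ x ] xs) (++-assoc pre [ x ] ys) (after (pre ++ [ x ]) p)
  after pre (↭.swap {xs} {ys} x y p) =
    trans (f-swap (AdjacentSwap-++ˡ pre (here x y xs)))
          (subst₂ (λ u v → f u ≡ f v) (++-assoc pre (y ∷ [ x ]) xs) (++-assoc pre (y ∷ [ x ]) ys)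
                  (after (pre ++ y ∷ [ x ]) p))
  after pre (↭.trans p q)            = trans (after pre p) (after pre q)

x≡-x⇒x≡0 : ∀ x → x ≡ - x → x ≡ 0ℤ
x≡-x⇒x≡0 (+ zero)  _  = refl
x≡-x⇒x≡0 (+ suc n) ()
x≡-x⇒x≡0 -[1+ n ]  ()

laplace-swap : ∀ (g : Y → List Y → ℤ) → (∀ c {l l′} → AdjacentSwap l l′ → g c l′ ≡ - g c l) →
               ∀ {cs cs′} → AdjacentSwap cs cs′ → laplace g cs′ ≡ - laplace g cs
laplace-swap g g-alt (here a b l) = begin
  g b (a ∷ l) - (g a (b ∷ l) - laplace (λ c m → g c (b ∷ a ∷ m)) l)
    ≡⟨ cong (λ z → g b (a ∷ l) - (g a (b ∷ l) - z))
            (trans (laplace-cong l (λ _ _ _ → g-alt _ (here a b _))) (laplace-neg (λ c m → g c (a ∷ b ∷ m)) l)) ⟩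
  g b (a ∷ l) - (g a (b ∷ l) - - laplace (λ c m → g c (a ∷ b ∷ m)) l)
    ≡⟨ rearrange (g a (b ∷ l)) (g b (a ∷ l)) _ ⟩
  - (g a (b ∷ l) - (g b (a ∷ l) - laplace (λ c m → g c (a ∷ b ∷ m)) l)) ∎
  where
  open ≡-Reasoning
  rearrange : ∀ x y z → y - (x - - z) ≡ - (x - (y - z))
  rearrange = solve-∀
laplace-swap g g-alt (there c {l} {l′} s) =
  trans (cong₂ _-_ (g-alt c s) (laplace-swap (λ c′ m → g c′ (c ∷ m)) (λ c′ s′ → g-alt c′ (there c s′)) s))
          (neg-distrib-- (g c l) _)
  where
  neg-distrib-- : ∀ a b → - a - - b ≡ - (a - b)
  neg-distrib-- = solve-∀

minor-swapCols : ∀ (M : X → Y → ℤ) rs {cs cs′} → AdjacentSwap cs cs′ → minor M rs cs′ ≡ - minor M rs cs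
minor-swapCols M []       (here a b l)  = refl
minor-swapCols M []       (there c s)   = refl
minor-swapCols M (r ∷ rs) s =
  laplace-swap (λ c l → M r c * minor M rs l)
               (λ c s′ → trans (cong (M r c *_) (minor-swapCols M rs s′)) (sym (neg-distribʳ-* (M r c) _))) s

-- Expanding along two rows in the two possible orders gives opposite results.
laplace²-antisym : ∀ (h : Y → Y → List Y → ℤ) cs →
                   laplace (λ c l → laplace (h c) l) cs ≡ - laplace (λ c l → laplace (λ d → h d c) l) cs
laplace²-antisym h []       = refl
laplace²-antisym {Y = Y} h (x ∷ t) = begin
  α - laplace (λ c m → h c x m - laplace (hₓ c) m) t
    ≡⟨ cong (_-_ α) (split h₁ hₓ) ⟩
  α - (β - laplace² hₓ t)
    ≡⟨ cong (λ z → α - (β - z)) (laplace²-antisym hₓ t) ⟩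
  α - (β - - laplace² (λ c d → hₓ d c) t)
    ≡⟨ rearrange α β _ ⟩
  - (β - (α - laplace² (λ c d → hₓ d c) t))
    ≡⟨ cong -_ (cong (_-_ β) (sym (split (λ c → h x c) (λ c d → hₓ d c)))) ⟩
  - (β - laplace (λ c m → h x c m - laplace (λ d → hₓ d c) m) t) ∎
  where
  open ≡-Reasoning
  laplace² : (Y → Y → List Y → ℤ) → List Y → ℤ
  laplace² k = laplace (λ c l → laplace (k c) l)
  hₓ : Y → Y → List Y → ℤ
  hₓ c d k = h c d (x ∷ k)
  h₁ : Y → List Y → ℤ
  h₁ c m = h c x m
  α β : ℤ
  α = laplace (h x) t
  β = laplace h₁ t
  split : ∀ (g : Y → List Y → ℤ) (k : Y → Y → List Y → ℤ) →
          laplace (λ c m → g c m - laplace (k c) m) t ≡ laplace g t - laplace² k t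
  split g k = trans (laplace-+ g (λ c m → - laplace (k c) m) t)
                    (cong (_+_ (laplace g t)) (laplace-neg (λ c m → laplace (k c) m) t))
  rearrange : ∀ a b z → a - (b - - z) ≡ - (b - (a - z))
  rearrange = solve-∀

minor-swapRows : ∀ (M : X → Y → ℤ) {rs rs′} cs → AdjacentSwap rs rs′ → minor M rs′ cs ≡ - minor M rs cs
minor-swapRows M cs (there r {l} s) =
  trans (laplace-cong cs (λ {c} {m} _ _ _ → trans (cong (M r c *_) (minor-swapRows M m s))
                                                  (sym (neg-distribʳ-* (M r c) (minor M l m)))))
        (laplace-neg (λ c m → M r c * minor M l m) cs)
minor-swapRows M cs (here a b l) = begin
  laplace (λ c m → M b c * laplace (λ d k → M a d * minor M l k) m) cs
    ≡⟨ laplace-cong cs (λ {c} {m} _ _ _ → sym (laplace-*ˡ (M b c) (λ d k → M a d * minor M l k) m)) ⟩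
  laplace (λ c m → laplace (λ d k → M b c * (M a d * minor M l k)) m) cs
    ≡⟨ laplace²-antisym (λ c d k → M b c * (M a d * minor M l k)) cs ⟩
  - laplace (λ c m → laplace (λ d k → M b d * (M a c * minor M l k)) m) cs
    ≡⟨ cong -_ (laplace-cong cs (λ {c} {m} _ _ _ →
         trans (laplace-cong m (λ {d} {k} _ _ _ → exchange (M b d) (M a c) (minor M l k)))
               (laplace-*ˡ (M a c) (λ d k → M b d * minor M l k) m))) ⟩
  - laplace (λ c m → M a c * laplace (λ d k → M b d * minor M l k) m) cs ∎
  where
  open ≡-Reasoning
  exchange : ∀ u v w → u * (v * w) ≡ v * (u * w)
  exchange = solve-∀

minor-repeatedRow : ∀ (M : X → Y → ℤ) r rs cs → minor M (r ∷ r ∷ rs) cs ≡ 0ℤ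
minor-repeatedRow M r rs cs = x≡-x⇒x≡0 _ (minor-swapRows M cs (here r r rs))

minor-swapBoth : ∀ (M : X → X → ℤ) {xs ys} → AdjacentSwap xs ys → minor M xs xs ≡ minor M ys ys
minor-swapBoth M {xs} {ys} s =
  sym (trans (minor-swapRows M ys s) (trans (cong -_ (minor-swapCols M xs s)) (neg-involutive _)))

minor-↭ : ∀ (M : X → X → ℤ) {xs ys} → xs ↭ ys → minor M xs xs ≡ minor M ys ys
minor-↭ M = ↭-invariant (λ l → minor M l l) (minor-swapBoth M)

minor-blockTriangular : ∀ (M : X → Y → ℤ) rs cs rs′ cs′ → length rs ≡ length cs →
                        (∀ {r c} → r ∈ rs → c ∈ cs′ → M r c ≡ 0ℤ) →
                        minor M (rs ++ rs′) (cs ++ cs′) ≡ minor M rs cs * minor M rs′ cs′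
minor-blockTriangular M []       []      rs′ cs′ _ _ = sym (*-identityˡ (minor M rs′ cs′))
minor-blockTriangular M (r ∷ rs) cs      rs′ cs′ ∣rs∣≡∣cs∣ M≡0 = begin
  laplace (λ c l → M r c * minor M (rs ++ rs′) l) (cs ++ cs′)
    ≡⟨ laplace-++-zero _ cs cs′ (λ {c} l c∈ → trans (cong (_* minor M (rs ++ rs′) l) (M≡0 (here refl) c∈))
                                                    (*-zeroˡ (minor M (rs ++ rs′) l))) ⟩
  laplace (λ c l → M r c * minor M (rs ++ rs′) (l ++ cs′)) cs
    ≡⟨ laplace-cong cs (λ {c} {l} _ _ ∣l∣+1≡∣cs∣ → trans
         (cong (M r c *_) (minor-blockTriangular M rs l rs′ cs′
                                                 (ℕ.suc-injective (trans ∣rs∣≡∣cs∣ (sym ∣l∣+1≡∣cs∣)))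
                                                 (λ r∈ → M≡0 (there r∈))))
         (regroup (M r c) (minor M rs l) (minor M rs′ cs′))) ⟩
  laplace (λ c l → minor M rs′ cs′ * (M r c * minor M rs l)) cs
    ≡⟨ laplace-*ˡ (minor M rs′ cs′) (λ c l → M r c * minor M rs l) cs ⟩
  minor M rs′ cs′ * minor M (r ∷ rs) cs
    ≡⟨ *-comm (minor M rs′ cs′) (minor M (r ∷ rs) cs) ⟩
  minor M (r ∷ rs) cs * minor M rs′ cs′ ∎
  where
  open ≡-Reasoning
  regroup : ∀ a b d → a * (b * d) ≡ d * (a * b)
  regroup = solve-∀

minor-scale : ∀ (M : X → Y → ℤ) k rs cs → minor (λ r c → k * M r c) rs cs ≡ k ^ length rs * minor M rs cs
minor-scale M k []       []      = refl
minor-scale M k []       (_ ∷ _) = refl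
minor-scale M k (r ∷ rs) cs      =
  trans (laplace-cong cs (λ {c} {l} _ _ _ → trans (cong (k * M r c *_) (minor-scale M k rs l))
                                                   (regroup k (M r c) (k ^ length rs) (minor M rs l))))
        (laplace-*ˡ (k * k ^ length rs) (λ c l → M r c * minor M rs l) cs)
  where
  regroup : ∀ k a p d → (k * a) * (p * d) ≡ (k * p) * (a * d)
  regroup = solve-∀

minor-headRow-+ : ∀ (M : X → Y → ℤ) (v : Y → ℤ) r r′ rs cs → (∀ c → M r c ≡ M r′ c + v c) →
                  minor M (r ∷ rs) cs ≡ minor M (r′ ∷ rs) cs + laplace (λ c l → v c * minor M rs l) cs
minor-headRow-+ M v r r′ rs cs M≡ =
  trans (laplace-cong cs (λ {c} {l} _ _ _ → trans (cong (_* minor M rs l) (M≡ c))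
                                                   (*-distribʳ-+ (minor M rs l) (M r′ c) (v c))))
        (laplace-+ (λ c l → M r′ c * minor M rs l) (λ c l → v c * minor M rs l) cs)

minor-headCol-+ : ∀ (M M′ : X → Y → ℤ) rs c c₁ c₂ cs → (∀ {r} → r ∈ rs → M′ r c ≡ M r c₁ + M r c₂) →
                  (∀ {r d} → r ∈ rs → d ∈ cs → M′ r d ≡ M r d) →
                  minor M′ rs (c ∷ cs) ≡ minor M rs (c₁ ∷ cs) + minor M rs (c₂ ∷ cs)
minor-headCol-+ M M′ []       c c₁ c₂ cs _   _     = refl
minor-headCol-+ {Y = Y} M M′ (r ∷ rs) c c₁ c₂ cs M′≡ M′≡M = begin
  M′ r c * minor M′ rs cs - laplace (λ d l → M′ r d * minor M′ rs (c ∷ l)) cs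
    ≡⟨ cong₂ (λ u w → u * w - laplace (λ d l → M′ r d * minor M′ rs (c ∷ l)) cs)
             (M′≡ (here refl)) (minor-cong rs cs (λ r∈ d∈ → M′≡M (there r∈) d∈)) ⟩
  (M r c₁ + M r c₂) * minor M rs cs - laplace (λ d l → M′ r d * minor M′ rs (c ∷ l)) cs
    ≡⟨ cong (_-_ ((M r c₁ + M r c₂) * minor M rs cs)) (trans (laplace-cong cs expand) (laplace-+ P₁ P₂ cs)) ⟩
  (M r c₁ + M r c₂) * minor M rs cs - (laplace P₁ cs + laplace P₂ cs)
    ≡⟨ regroup (M r c₁) (M r c₂) (minor M rs cs) (laplace P₁ cs) (laplace P₂ cs) ⟩
  (M r c₁ * minor M rs cs - laplace P₁ cs) + (M r c₂ * minor M rs cs - laplace P₂ cs) ∎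
  where
  open ≡-Reasoning
  P₁ P₂ : Y → List Y → ℤ
  P₁ d l = M r d * minor M rs (c₁ ∷ l)
  P₂ d l = M r d * minor M rs (c₂ ∷ l)
  expand : ∀ {d l} → d ∈ cs → l ⊆ cs → suc (length l) ≡ length cs →
           M′ r d * minor M′ rs (c ∷ l) ≡ P₁ d l + P₂ d l
  expand {d} {l} d∈ l⊆ _ =
    trans (cong₂ _*_ (M′≡M (here refl) d∈)
                     (minor-headCol-+ M M′ rs c c₁ c₂ l (λ r∈ → M′≡ (there r∈))
                                                        (λ r∈ e∈ → M′≡M (there r∈) (l⊆ e∈))))
          (*-distribˡ-+ (M r d) (minor M rs (c₁ ∷ l)) (minor M rs (c₂ ∷ l)))
  regroup : ∀ a₁ a₂ d p q → (a₁ + a₂) * d - (p + q) ≡ (a₁ * d - p) + (a₂ * d - q)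
  regroup = solve-∀

-- Characteristic polynomials

δ-refl : ∀ {n} (i : Fin n) → δ i i ≡ 1ℤ
δ-refl zero    = refl
δ-refl (suc i) = δ-refl i

δ-≢ : ∀ {n} {i j : Fin n} → i ≢ j → δ i j ≡ 0ℤ
δ-≢ {i = zero}  {zero}  i≢j = contradiction refl i≢j
δ-≢ {i = zero}  {suc j} _   = refl
δ-≢ {i = suc i} {zero}  _   = refl
δ-≢ {i = suc i} {suc j} i≢j = δ-≢ (i≢j ∘ cong suc)

δ-injective : ∀ {m n} {φ : Fin m → Fin n} → Injective _≡_ _≡_ φ → ∀ a b → δ (φ a) (φ b) ≡ δ a b
δ-injective {φ = φ} φ-injective a b with a ≟ b
... | yes refl = trans (δ-refl (φ a)) (sym (δ-refl a))
... | no a≢b   = trans (δ-≢ (a≢b ∘ φ-injective)) (sym (δ-≢ a≢b))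

charMatrix : ∀ {n} → ℤ → Matrix n → Matrix n
charMatrix x A i j = x * δ i j - A i j

det-Poly< : ∀ n (M : ℤ → Matrix n) → (∀ i j → Poly< 2 (λ x → M x i j)) → Poly< (suc n) (λ x → det n (M x))
det-Poly< zero    M _  = Poly<-const 1ℤ
det-Poly< (suc n) M pM = Poly<-∑ (suc n) λ j →
  Poly<-*ˡ (sign (toℕ j)) (Poly<-* (pM zero j) (det-Poly< n _ (λ r c → pM (suc r) (punchIn j c))))

Poly<-affine : ∀ a b → Poly< 2 (λ x → x * a - b)
Poly<-affine a b = horner (- b) (Poly<-const a) (λ x → +-comm (x * a) (- b))

-- Along the first row, the (0, 0) term is (x - A₀₀) times a smaller characteristic polynomial;
-- every other term is a constant times an n × n minor with affine entries, of degree ≤ n.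
charPoly-monic : ∀ n (A : Matrix n) → Monic n (charPoly n A)
charPoly-monic zero    A = x^-monic 0
charPoly-monic (suc n) A = Monic-+ first-term other-terms
  where
  A′ : Matrix n
  A′ i j = A (suc i) (suc j)
  first-term : Monic (suc n) (λ x → 1ℤ * ((x * 1ℤ - A zero zero) * charPoly n A′ x))
  first-term = Monic-resp-≗ (Monic-* (x-μ-monic (A zero zero)) (charPoly-monic n A′))
    (λ x → sym (trans (*-identityˡ _) (cong (λ y → (y - A zero zero) * charPoly n A′ x) (*-identityʳ x))))
  other-terms : Poly< (suc n) (λ x → ∑ n λ j → sign (toℕ (suc j)) *
                  ((x * 0ℤ - A zero (suc j)) * det n (λ r c → charMatrix x A (suc r) (punchIn (suc j) c))))
  other-terms = Poly<-∑ n λ j → Poly<-*ˡ (sign (toℕ (suc j)))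
    (Poly<-* (horner (- A zero (suc j)) (vanishing (λ _ → refl)) (λ x → +-comm (x * 0ℤ) (- A zero (suc j))))
             (det-Poly< n _ (λ r c → Poly<-affine (δ (suc r) (punchIn (suc j) c)) (A (suc r) (punchIn (suc j) c)))))

-- Lists and block diagonal matrices

Unique-resp-↭ : ∀ {xs ys : List A} → xs ↭ ys → Unique xs → Unique ys
Unique-resp-↭ {A = A} p = ↭ₛ.Unique-resp-↭ (setoid A) (↭⇒↭ₛ p)

unique-sameElements-↭ : ∀ {xs ys : List A} → Unique xs → Unique ys →
                        (∀ {z} → z ∈ xs → z ∈ ys) → (∀ {z} → z ∈ ys → z ∈ xs) → xs ↭ ys
unique-sameElements-↭ unique-xs unique-ys xs⊆ys ys⊆xs =
  ∼bag⇒↭ (unique∧set⇒bag unique-xs unique-ys (mk⇔ xs⊆ys ys⊆xs))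

filter-split-↭ : ∀ {P : Pred A 0ℓ} (P? : Decidable P) xs → xs ↭ filter P? xs ++ filter (∁? P?) xs
filter-split-↭ {A = A} P? xs =
  subst (λ (ys , zs) → xs ↭ ys ++ zs) (partition-defn P? xs) (↭ₛ⇒↭ (↭ₛ.partition-↭ (setoid A) P? xs))

-- M is block diagonal with every block a copy of N: the block of y is enumerated by ψ y,
-- and the blocks are the classes of an equivalence relation.
module BlockDiagonal {X : Set} {m : ℕ} (ψ : X → Fin m → X) (ψ-injective : ∀ y → Injective _≡_ _≡_ (ψ y))
  (blocks : IsDecEquivalence (λ z y → ∃[ a ] ψ y a ≡ z))
  (M : X → X → ℤ) (N : Matrix m)
  (M-block : ∀ y a b → M (ψ y a) (ψ y b) ≡ N a b)
  (M-offBlock : ∀ {r c} → ¬ (∃[ a ] ψ c a ≡ r) → M r c ≡ 0ℤ) where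

  _~_ : X → X → Set
  z ~ y = ∃[ a ] ψ y a ≡ z

  open IsDecEquivalence blocks using () renaming (refl to ~-refl; sym to ~-sym; trans to ~-trans; _≟_ to _~?_)

  Closed : List X → Set
  Closed ℓ = ∀ {y z} → z ~ y → y ∈ ℓ → z ∈ ℓ

  block rest : X → List X → List X
  block y = filter (_~? y)
  rest  y = filter (∁? (_~? y))

  module _ {y ℓ} (y∈ℓ : y ∈ ℓ) (unique-ℓ : Unique ℓ) (closed-ℓ : Closed ℓ) where

    enumerate-block : map (ψ y) (allFin m) ↭ block y ℓ
    enumerate-block =
      unique-sameElements-↭ (Unique.map⁺ (ψ-injective y) (Unique.allFin⁺ m)) (Unique.filter⁺ (_~? y) unique-ℓ)
        (λ z∈ → let a , _ , z≡ψa = ∈-map⁻ (ψ y) z∈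
                in ∈-filter⁺ (_~? y) (closed-ℓ (a , sym z≡ψa) y∈ℓ) (a , sym z≡ψa))
        (λ z∈ → let _ , a , ψa≡z = ∈-filter⁻ (_~? y) {xs = ℓ} z∈
                in subst (_∈ map (ψ y) (allFin m)) ψa≡z (∈-map⁺ (ψ y) (∈-allFin a)))

    length-block : length (block y ℓ) ≡ m
    length-block = trans (sym (↭-length enumerate-block)) (trans (length-map (ψ y) (allFin m)) (length-tabulate id))

    minor-block : minor M (block y ℓ) (block y ℓ) ≡ det m N
    minor-block = begin
      minor M (block y ℓ) (block y ℓ)
        ≡⟨ minor-↭ M (↭-sym enumerate-block) ⟩
      minor M (map (ψ y) (allFin m)) (map (ψ y) (allFin m))
        ≡⟨ minor-map M (ψ y) (ψ y) (allFin m) (allFin m) ⟩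
      minor (λ a b → M (ψ y a) (ψ y b)) (allFin m) (allFin m)
        ≡⟨ minor-cong (allFin m) (allFin m) (λ {a} {b} _ _ → M-block y a b) ⟩
      minor N (allFin m) (allFin m)
        ≡⟨ sym (det≡minor m N) ⟩
      det m N ∎
      where open ≡-Reasoning

    minor-peelBlock : minor M ℓ ℓ ≡ det m N * minor M (rest y ℓ) (rest y ℓ)
    minor-peelBlock = begin
      minor M ℓ ℓ
        ≡⟨ minor-↭ M (filter-split-↭ (_~? y) ℓ) ⟩
      minor M (block y ℓ ++ rest y ℓ) (block y ℓ ++ rest y ℓ)
        ≡⟨ minor-blockTriangular M (block y ℓ) (block y ℓ) (rest y ℓ) (rest y ℓ) refl off-block ⟩
      minor M (block y ℓ) (block y ℓ) * minor M (rest y ℓ) (rest y ℓ)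
        ≡⟨ cong (_* minor M (rest y ℓ) (rest y ℓ)) minor-block ⟩
      det m N * minor M (rest y ℓ) (rest y ℓ) ∎
      where
      open ≡-Reasoning
      off-block : ∀ {r c} → r ∈ block y ℓ → c ∈ rest y ℓ → M r c ≡ 0ℤ
      off-block r∈ c∈ = M-offBlock λ r~c →
        proj₂ (∈-filter⁻ (∁? (_~? y)) {xs = ℓ} c∈) (~-trans (~-sym r~c) (proj₂ (∈-filter⁻ (_~? y) {xs = ℓ} r∈)))

    length-peelBlock : length ℓ ≡ m ℕ.+ length (rest y ℓ)
    length-peelBlock = trans (↭-length (filter-split-↭ (_~? y) ℓ))
                             (trans (length-++ (block y ℓ)) (cong (ℕ._+ length (rest y ℓ)) length-block))

  rest-closed : ∀ {y ℓ} → Closed ℓ → Closed (rest y ℓ)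
  rest-closed {y} {ℓ} closed-ℓ z~w w∈ =
    let w∈ℓ , w≁y = ∈-filter⁻ (∁? (_~? y)) {xs = ℓ} w∈
    in ∈-filter⁺ (∁? (_~? y)) (closed-ℓ z~w w∈ℓ) (λ z~y → w≁y (~-trans (~-sym z~w) z~y))

  minor-blockDiagonal : ∀ ℓ → Unique ℓ → Closed ℓ → ∃[ q ] length ℓ ≡ q ℕ.* m × minor M ℓ ℓ ≡ det m N ^ q
  minor-blockDiagonal ℓ = go (length ℓ) ℓ ℕ.≤-refl
    where
    go : ∀ k ℓ → length ℓ ≤ k → Unique ℓ → Closed ℓ →
         ∃[ q ] length ℓ ≡ q ℕ.* m × minor M ℓ ℓ ≡ det m N ^ q
    go _       []      _           _        _        = 0 , refl , refl
    go (suc k) (y ∷ t) (s≤s ∣t∣≤k) unique-ℓ closed-ℓ =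
      let q , ∣rest∣≡ , minor-rest≡ =
            go k (rest y (y ∷ t)) ∣rest∣≤k (Unique.filter⁺ (∁? (_~? y)) unique-ℓ) (rest-closed closed-ℓ)
      in suc q , trans (length-peelBlock (here refl) unique-ℓ closed-ℓ) (cong (m ℕ.+_) ∣rest∣≡)
               , trans (minor-peelBlock (here refl) unique-ℓ closed-ℓ) (cong (det m N *_) minor-rest≡)
      where
      ∣rest∣≤k : length (rest y (y ∷ t)) ≤ k
      ∣rest∣≤k = subst (λ l → length l ≤ k) (sym (filter-reject (∁? (_~? y)) (λ y≁y → y≁y ~-refl)))
                       (ℕ.≤-trans (length-filter (∁? (_~? y)) t) ∣t∣≤k)

-- Merging the points of a fibre

-- Subtracting row b from row a leaves the row x (eₐ - e_b), with only two nonzero entries.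
minor-headRows-differ : ∀ {n} (M : Matrix n) x a b L → Unique (a ∷ b ∷ L) →
                        (∀ c → M a c ≡ M b c + (x * δ a c - x * δ b c)) →
                        minor M (a ∷ b ∷ L) (a ∷ b ∷ L) ≡ x * (minor M (b ∷ L) (b ∷ L) + minor M (b ∷ L) (a ∷ L))
minor-headRows-differ {n} M x a b L (a≢bL ∷ b≢L ∷ _) row-a = begin
  minor M (a ∷ b ∷ L) (a ∷ b ∷ L)
    ≡⟨ minor-headRow-+ M v a b (b ∷ L) (a ∷ b ∷ L) row-a ⟩
  minor M (b ∷ b ∷ L) (a ∷ b ∷ L) + laplace (λ c l → v c * D l) (a ∷ b ∷ L)
    ≡⟨ trans (cong (_+ laplace (λ c l → v c * D l) (a ∷ b ∷ L)) (minor-repeatedRow M b L (a ∷ b ∷ L)))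
             (+-identityˡ (laplace (λ c l → v c * D l) (a ∷ b ∷ L))) ⟩
  v a * D (b ∷ L) - (v b * D (a ∷ L) - laplace (λ c l → v c * D (a ∷ b ∷ l)) L)
    ≡⟨ cong₂ (λ p q → p * D (b ∷ L) - (q * D (a ∷ L) - laplace (λ c l → v c * D (a ∷ b ∷ l)) L)) v-a v-b ⟩
  x * D (b ∷ L) - (- x * D (a ∷ L) - laplace (λ c l → v c * D (a ∷ b ∷ l)) L)
    ≡⟨ cong (λ z → x * D (b ∷ L) - (- x * D (a ∷ L) - z))
            (laplace-zero (λ c l → v c * D (a ∷ b ∷ l)) L
                          (λ {c} l c∈L → trans (cong (_* D (a ∷ b ∷ l)) (v-L c∈L)) (*-zeroˡ (D (a ∷ b ∷ l))))) ⟩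
  x * D (b ∷ L) - (- x * D (a ∷ L) - 0ℤ)
    ≡⟨ collect x (D (b ∷ L)) (D (a ∷ L)) ⟩
  x * (D (b ∷ L) + D (a ∷ L)) ∎
  where
  open ≡-Reasoning
  D : List (Fin n) → ℤ
  D = minor M (b ∷ L)
  v : Fin n → ℤ
  v c = x * δ a c - x * δ b c
  v-a : v a ≡ x
  v-a = trans (cong₂ (λ p q → x * p - x * q) (δ-refl a) (δ-≢ (All.head a≢bL ∘ sym))) (lemma x)
    where
    lemma : ∀ x → x * 1ℤ - x * 0ℤ ≡ x
    lemma = solve-∀
  v-b : v b ≡ - x
  v-b = trans (cong₂ (λ p q → x * p - x * q) (δ-≢ (All.head a≢bL)) (δ-refl b)) (lemma x)
    where
    lemma : ∀ x → x * 0ℤ - x * 1ℤ ≡ - x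
    lemma = solve-∀
  v-L : ∀ {c} → c ∈ L → v c ≡ 0ℤ
  v-L c∈L = trans (cong₂ (λ p q → x * p - x * q) (δ-≢ (All.lookup (All.tail a≢bL) c∈L)) (δ-≢ (All.lookup b≢L c∈L)))
                  (lemma x)
    where
    lemma : ∀ x → x * 0ℤ - x * 0ℤ ≡ 0ℤ
    lemma = solve-∀
  collect : ∀ x p q → x * p - (- x * q - 0ℤ) ≡ x * (p + q)
  collect = solve-∀

module Merge {n k : ℕ} (F : Fin n → Fin k) (B : Matrix k) where

  pullback : (Fin n → ℤ) → Matrix n
  pullback w r s = B (F r) (F s) * w s

  weighted : (Fin k → ℤ) → Matrix k
  weighted W a b = B a b * W b

  -- Rows a and b of x I - pullback w differ by x (eₐ - e_b), as F a ≡ F b; column b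
  -- of the merged matrix is the sum of columns a and b.
  merge : ∀ x w a b L → Unique (a ∷ b ∷ L) → F a ≡ F b →
          minor (charMatrix x (pullback w)) (a ∷ b ∷ L) (a ∷ b ∷ L)
            ≡ x * minor (charMatrix x (pullback (updateAt w b (_+_ (w a))))) (b ∷ L) (b ∷ L)
  merge x w a b L unique@(a≢bL ∷ b≢L ∷ _) Fa≡Fb =
    trans (minor-headRows-differ M x a b L unique row-a)
          (cong (x *_) (sym (minor-headCol-+ M M′ (b ∷ L) b b a L col-b other-cols)))
    where
    M M′ : Matrix n
    M  = charMatrix x (pullback w)
    M′ = charMatrix x (pullback (updateAt w b (_+_ (w a))))
    row-a : ∀ c → M a c ≡ M b c + (x * δ a c - x * δ b c)
    row-a c = trans (cong (λ y → x * δ a c - B y (F c) * w c) Fa≡Fb) (split (x * δ a c) (x * δ b c) (B (F b) (F c) * w c))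
      where
      split : ∀ p q t → p - t ≡ (q - t) + (p - q)
      split = solve-∀
    col-b : ∀ {r} → r ∈ b ∷ L → M′ r b ≡ M r b + M r a
    col-b {r} r∈bL =
      trans (cong (λ z → x * δ r b - B (F r) (F b) * z) (updateAt-updates b w))
            (trans (split x (x * δ r b) (B (F r) (F b)) (w a) (w b))
                   (cong (_+_ (M r b)) (sym (cong₂ (λ p y → x * p - B (F r) y * w a) (δ-≢ r≢a) Fa≡Fb))))
      where
      r≢a : r ≢ a
      r≢a r≡a = All.lookup a≢bL (subst (_∈ b ∷ L) r≡a r∈bL) refl
      split : ∀ x p t u v → p - t * (u + v) ≡ (p - t * v) + (x * 0ℤ - t * u)
      split = solve-∀
    other-cols : ∀ {r d} → r ∈ b ∷ L → d ∈ L → M′ r d ≡ M r d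
    other-cols {r} {d} _ d∈L =
      cong (λ z → x * δ r d - B (F r) (F d) * z) (updateAt-minimal d b w (λ d≡b → All.lookup b≢L d∈L (sym d≡b)))

  fibreSum : List (Fin n) → (Fin n → ℤ) → Fin k → ℤ
  fibreSum []      w y = 0ℤ
  fibreSum (g ∷ ℓ) w y = δ (F g) y * w g + fibreSum ℓ w y

  fibreSum-↭ : ∀ w y {ℓ ℓ′} → ℓ ↭ ℓ′ → fibreSum ℓ w y ≡ fibreSum ℓ′ w y
  fibreSum-↭ w y ↭.refl                  = refl
  fibreSum-↭ w y (↭.prep g p)            = cong (_+_ (δ (F g) y * w g)) (fibreSum-↭ w y p)
  fibreSum-↭ w y (↭.swap {ys = ℓ′} g h p) =
    trans (cong (λ z → δ (F g) y * w g + (δ (F h) y * w h + z)) (fibreSum-↭ w y p))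
          (+-left-comm (δ (F g) y * w g) (δ (F h) y * w h) (fibreSum ℓ′ w y))
    where
    +-left-comm : ∀ a b c → a + (b + c) ≡ b + (a + c)
    +-left-comm = solve-∀
  fibreSum-↭ w y (↭.trans p q)           = trans (fibreSum-↭ w y p) (fibreSum-↭ w y q)

  fibreSum-cong : ∀ {w w′} y ℓ → (∀ {g} → g ∈ ℓ → w g ≡ w′ g) → fibreSum ℓ w y ≡ fibreSum ℓ w′ y
  fibreSum-cong y []      _    = refl
  fibreSum-cong y (g ∷ ℓ) w≡w′ =
    cong₂ (λ u z → δ (F g) y * u + z) (w≡w′ (here refl)) (fibreSum-cong y ℓ (w≡w′ ∘ there))

  fibreSum-outside : ∀ w y ℓ → (∀ {g} → g ∈ ℓ → F g ≢ y) → fibreSum ℓ w y ≡ 0ℤ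
  fibreSum-outside w y []      _     = refl
  fibreSum-outside w y (g ∷ ℓ) Fg≢y =
    cong₂ (λ d z → d * w g + z) (δ-≢ (Fg≢y (here refl))) (fibreSum-outside w y ℓ (Fg≢y ∘ there))

  fibreSum-injective : ∀ w ℓ → Unique (map F ℓ) → ∀ {s} → s ∈ ℓ → fibreSum ℓ w (F s) ≡ w s
  fibreSum-injective w (g ∷ ℓ) (Fg∉ ∷ _) (here refl) =
    trans (cong₂ (λ d z → d * w g + z) (δ-refl (F g))
                 (fibreSum-outside w (F g) ℓ (λ h∈ Fh≡Fg → All.lookup Fg∉ (∈-map⁺ F h∈) (sym Fh≡Fg))))
          (trans (+-identityʳ (1ℤ * w g)) (*-identityˡ (w g)))
  fibreSum-injective w (g ∷ ℓ) (Fg∉ ∷ unique) {s} (there s∈) =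
    trans (cong (λ d → d * w g + fibreSum ℓ w (F s)) (δ-≢ (All.lookup Fg∉ (∈-map⁺ F s∈))))
          (trans (+-identityˡ (fibreSum ℓ w (F s))) (fibreSum-injective w ℓ unique s∈))

  fibreSum-ones : ∀ ℓ y → fibreSum ℓ (const 1ℤ) y ≡ + length (filter (λ z → F z ≟ y) ℓ)
  fibreSum-ones []      y = refl
  fibreSum-ones (z ∷ ℓ) y with F z ≟ y
  ... | yes refl = trans (cong (λ d → d * 1ℤ + fibreSum ℓ (const 1ℤ) (F z)) (δ-refl (F z)))
                         (cong (_+_ 1ℤ) (fibreSum-ones ℓ (F z)))
  ... | no Fz≢y  = trans (cong (λ d → d * 1ℤ + fibreSum ℓ (const 1ℤ) y) (δ-≢ Fz≢y))
                         (trans (+-identityˡ (fibreSum ℓ (const 1ℤ) y)) (fibreSum-ones ℓ y))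

  Unique-map⇒injectiveOn : ∀ {ℓ r s} → Unique (map F ℓ) → r ∈ ℓ → s ∈ ℓ → F r ≡ F s → r ≡ s
  Unique-map⇒injectiveOn (_   ∷ _)      (here refl) (here refl) _     = refl
  Unique-map⇒injectiveOn (Fg∉ ∷ _)      (here refl) (there s∈)  Fr≡Fs =
    contradiction Fr≡Fs (All.lookup Fg∉ (∈-map⁺ F s∈))
  Unique-map⇒injectiveOn (Fg∉ ∷ _)      (there r∈)  (here refl) Fr≡Fs =
    contradiction (sym Fr≡Fs) (All.lookup Fg∉ (∈-map⁺ F r∈))
  Unique-map⇒injectiveOn (_   ∷ unique) (there r∈)  (there s∈)  Fr≡Fs = Unique-map⇒injectiveOn unique r∈ s∈ Fr≡Fs

  Collision : List (Fin n) → Set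
  Collision ℓ = ∃[ a ] ∃[ b ] ∃[ L ] ℓ ↭ a ∷ b ∷ L × F a ≡ F b

  collision? : ∀ ℓ → Collision ℓ ⊎ Unique (map F ℓ)
  collision? []      = inj₂ []
  collision? (g ∷ t) with Any.any? (λ h → F g ≟ F h) t | collision? t
  ... | yes Fg∈F[t] | _ with find Fg∈F[t]
  ...   | h , h∈t , Fg≡Fh with ∈-∃++ h∈t
  ...     | pre , post , refl = inj₁ (g , h , pre ++ post , ↭.prep g (shift h pre post) , Fg≡Fh)
  collision? (g ∷ t) | no _ | inj₁ (a , b , L , t↭ , Fa≡Fb) =
    inj₁ (a , b , g ∷ L , ↭.trans (↭.prep g t↭) (↭-sym (shift g (a ∷ b ∷ []) L)) , Fa≡Fb)
  collision? (g ∷ t) | no Fg∉F[t] | inj₂ unique = inj₂ (Allₚ.map⁺ (Allₚ.¬Any⇒All¬ t Fg∉F[t]) ∷ unique)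

  fibreSum-merge : ∀ {ℓ} w a b L → ℓ ↭ a ∷ b ∷ L → Unique (a ∷ b ∷ L) → F a ≡ F b →
                   ∀ y → fibreSum (b ∷ L) (updateAt w b (_+_ (w a))) y ≡ fibreSum ℓ w y
  fibreSum-merge {ℓ} w a b L ℓ↭ (_ ∷ b∉L ∷ _) Fa≡Fb y = begin
    δ (F b) y * updateAt w b (_+_ (w a)) b + fibreSum L (updateAt w b (_+_ (w a))) y
      ≡⟨ cong₂ (λ u z → δ (F b) y * u + z) (updateAt-updates b w)
               (fibreSum-cong y L (λ c∈L → updateAt-minimal _ b w (λ c≡b → All.lookup b∉L c∈L (sym c≡b)))) ⟩
    δ (F b) y * (w a + w b) + fibreSum L w y
      ≡⟨ split (δ (F b) y) (w a) (w b) (fibreSum L w y) ⟩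
    δ (F b) y * w a + (δ (F b) y * w b + fibreSum L w y)
      ≡⟨ cong (λ z → δ z y * w a + (δ (F b) y * w b + fibreSum L w y)) (sym Fa≡Fb) ⟩
    fibreSum (a ∷ b ∷ L) w y
      ≡⟨ fibreSum-↭ w y (↭-sym ℓ↭) ⟩
    fibreSum ℓ w y ∎
    where
    open ≡-Reasoning
    split : ∀ d u v t → d * (u + v) + t ≡ d * u + (d * v + t)
    split = solve-∀

  record Compression (ℓ : List (Fin n)) (w : Fin n → ℤ) : Set where
    field
      targets        : List (Fin k)
      excess         : ℕ
      targets-unique : Unique targets
      targets-cover  : ∀ {g} → g ∈ ℓ → F g ∈ targets
      length-≡       : length ℓ ≡ excess ℕ.+ length targets
      minor-≡        : ∀ x → minor (charMatrix x (pullback w)) ℓ ℓ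
                               ≡ x ^ excess * minor (charMatrix x (weighted (fibreSum ℓ w))) targets targets

  compress-injective : ∀ ℓ w → Unique (map F ℓ) → Compression ℓ w
  compress-injective ℓ w unique = record
    { targets        = map F ℓ
    ; excess         = 0
    ; targets-unique = unique
    ; targets-cover  = ∈-map⁺ F
    ; length-≡       = sym (length-map F ℓ)
    ; minor-≡        = λ x → begin
        minor (charMatrix x (pullback w)) ℓ ℓ
          ≡⟨ minor-cong ℓ ℓ (λ {r} {s} r∈ s∈ → cong₂ (λ d u → x * d - B (F r) (F s) * u)
                                                      (sym (δ-F r∈ s∈)) (sym (fibreSum-injective w ℓ unique s∈))) ⟩
        minor (λ r s → charMatrix x (weighted (fibreSum ℓ w)) (F r) (F s)) ℓ ℓ
          ≡⟨ sym (minor-map (charMatrix x (weighted (fibreSum ℓ w))) F F ℓ ℓ) ⟩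
        minor (charMatrix x (weighted (fibreSum ℓ w))) (map F ℓ) (map F ℓ)
          ≡⟨ sym (*-identityˡ _) ⟩
        x ^ 0 * minor (charMatrix x (weighted (fibreSum ℓ w))) (map F ℓ) (map F ℓ) ∎
    }
    where
    open ≡-Reasoning
    δ-F : ∀ {r s} → r ∈ ℓ → s ∈ ℓ → δ (F r) (F s) ≡ δ r s
    δ-F {r} {s} r∈ s∈ with r ≟ s
    ... | yes refl = trans (δ-refl (F r)) (sym (δ-refl r))
    ... | no r≢s   = trans (δ-≢ (r≢s ∘ Unique-map⇒injectiveOn unique r∈ s∈)) (sym (δ-≢ r≢s))

  compress-collision : ∀ ℓ w a b L → Unique ℓ → ℓ ↭ a ∷ b ∷ L → F a ≡ F b →
                       Compression (b ∷ L) (updateAt w b (_+_ (w a))) → Compression ℓ w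
  compress-collision ℓ w a b L unique-ℓ ℓ↭ Fa≡Fb c = record
    { targets        = targets
    ; excess         = suc excess
    ; targets-unique = targets-unique
    ; targets-cover  = cover
    ; length-≡       = trans (↭-length ℓ↭) (cong suc length-≡)
    ; minor-≡        = λ x → begin
        minor (charMatrix x (pullback w)) ℓ ℓ
          ≡⟨ minor-↭ _ ℓ↭ ⟩
        minor (charMatrix x (pullback w)) (a ∷ b ∷ L) (a ∷ b ∷ L)
          ≡⟨ merge x w a b L unique-abL Fa≡Fb ⟩
        x * minor (charMatrix x (pullback w′)) (b ∷ L) (b ∷ L)
          ≡⟨ cong (x *_) (minor-≡ x) ⟩
        x * (x ^ excess * minor (charMatrix x (weighted (fibreSum (b ∷ L) w′))) targets targets)
          ≡⟨ sym (*-assoc x (x ^ excess) _) ⟩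
        x ^ suc excess * minor (charMatrix x (weighted (fibreSum (b ∷ L) w′))) targets targets
          ≡⟨ cong (x ^ suc excess *_) (minor-cong targets targets (λ {e} {d} _ _ →
               cong (λ u → x * δ e d - B e d * u) (fibreSum-merge w a b L ℓ↭ unique-abL Fa≡Fb d))) ⟩
        x ^ suc excess * minor (charMatrix x (weighted (fibreSum ℓ w))) targets targets ∎
    }
    where
    open ≡-Reasoning
    open Compression c
    w′ : Fin n → ℤ
    w′ = updateAt w b (_+_ (w a))
    unique-abL : Unique (a ∷ b ∷ L)
    unique-abL = Unique-resp-↭ ℓ↭ unique-ℓ
    cover : ∀ {g} → g ∈ ℓ → F g ∈ targets
    cover g∈ with ∈-resp-↭ ℓ↭ g∈
    ... | here refl  = subst (_∈ targets) (sym Fa≡Fb) (targets-cover (here refl))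
    ... | there g∈bL = targets-cover g∈bL

  compress : ∀ ℓ → Unique ℓ → ∀ w → Compression ℓ w
  compress ℓ = go (length ℓ) ℓ ℕ.≤-refl
    where
    go : ∀ m ℓ → length ℓ ≤ m → Unique ℓ → ∀ w → Compression ℓ w
    go m       ℓ ∣ℓ∣≤m unique-ℓ w with collision? ℓ
    go m       ℓ _     _        w | inj₂ unique-Fℓ = compress-injective ℓ w unique-Fℓ
    go zero    ℓ ∣ℓ∣≤0 _        _ | inj₁ (_ , _ , _ , ℓ↭ , _) =
      contradiction (subst (_≤ 0) (↭-length ℓ↭) ∣ℓ∣≤0) λ ()
    go (suc m) ℓ ∣ℓ∣≤m unique-ℓ w | inj₁ (a , b , L , ℓ↭ , Fa≡Fb) =
      compress-collision ℓ w a b L unique-ℓ ℓ↭ Fa≡Fb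
        (go m (b ∷ L) (ℕ.≤-pred (subst (_≤ suc m) (↭-length ℓ↭) ∣ℓ∣≤m))
            (AllPairs.tail (Unique-resp-↭ ℓ↭ unique-ℓ)) (updateAt w b (_+_ (w a))))

-- Cayley graphs of subgroups and quotients

asGroup : ∀ {n} → FinGroup n → Group 0ℓ 0ℓ
asGroup {n} G = record { Carrier = Fin n ; _≈_ = _≡_ ; _∙_ = _∙_ G ; ε = ε G ; _⁻¹ = _⁻¹ G ; isGroup = isGroup G }

module _ {n m} (G : FinGroup n) (H : FinGroup m) {f : Fin n → Fin m} (f-hom : IsHom G H f) where
  private
    module G = Group (asGroup G)
    module H = Group (asGroup H)
    module HP = GroupProperties (asGroup H)

  IsHom-ε : f G.ε ≡ H.ε
  IsHom-ε = HP.identityʳ-unique (f G.ε) (f G.ε) (trans (sym (f-hom G.ε G.ε)) (cong f (G.identityˡ G.ε)))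

  IsHom-⁻¹ : ∀ x → f (x G.⁻¹) ≡ f x H.⁻¹
  IsHom-⁻¹ x = HP.inverseʳ-unique (f x) (f (x G.⁻¹)) (trans (sym (f-hom x (x G.⁻¹))) (trans (cong f (G.inverseʳ x)) IsHom-ε))

preimage : ∀ {n k} → (Fin n → Fin k) → Subset k → Subset n
preimage f S = Vec.tabulate (Vec.lookup S ∘ f)

module _ {n k} (G : FinGroup n) (K : FinGroup k) {f : Fin n → Fin k} (f-hom : IsHom G K f) {S : Subset k} where
  private
    module G = Group (asGroup G)
    module K = Group (asGroup K)

  preimage-symmetric : Symmetric K S → Symmetric G (preimage f S)
  preimage-symmetric S-symmetric y y∈ = Vec.lookup⇒[]= (y G.⁻¹) (preimage f S) (begin
    Vec.lookup (preimage f S) (y G.⁻¹) ≡⟨ Vec.lookup∘tabulate (Vec.lookup S ∘ f) (y G.⁻¹) ⟩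
    Vec.lookup S (f (y G.⁻¹))          ≡⟨ cong (Vec.lookup S) (IsHom-⁻¹ G K f-hom y) ⟩
    Vec.lookup S (f y K.⁻¹)            ≡⟨ Vec.[]=⇒lookup (S-symmetric (f y) (Vec.lookup⇒[]= (f y) S fy∈S)) ⟩
    true                               ∎)
    where
    open ≡-Reasoning
    fy∈S : Vec.lookup S (f y) ≡ true
    fy∈S = trans (sym (Vec.lookup∘tabulate (Vec.lookup S ∘ f) y)) (Vec.[]=⇒lookup y∈)

  cayleyAdj-preimage : ∀ r s → cayleyAdj G (preimage f S) r s ≡ cayleyAdj K S (f r) (f s)
  cayleyAdj-preimage r s = cong (if_then 1ℤ else 0ℤ) (begin
    Vec.lookup (preimage f S) (r G.∙ s G.⁻¹) ≡⟨ Vec.lookup∘tabulate (Vec.lookup S ∘ f) (r G.∙ s G.⁻¹) ⟩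
    Vec.lookup S (f (r G.∙ s G.⁻¹))          ≡⟨ cong (Vec.lookup S) (f-hom r (s G.⁻¹)) ⟩
    Vec.lookup S (f r K.∙ f (s G.⁻¹))        ≡⟨ cong (λ z → Vec.lookup S (f r K.∙ z)) (IsHom-⁻¹ G K f-hom s) ⟩
    Vec.lookup S (f r K.∙ f s K.⁻¹)          ∎)
    where open ≡-Reasoning

module _ {m n} (f : Fin m → Fin n) (S : Subset m) where

  imageMember : Fin n → Bool
  imageMember y with any? (λ k → f k ≟ y)
  ... | yes (k , _) = Vec.lookup S k
  ... | no _        = false

  image : Subset n
  image = Vec.tabulate imageMember

  lookup-image : Injective _≡_ _≡_ f → ∀ k → Vec.lookup image (f k) ≡ Vec.lookup S k
  lookup-image f-injective k with any? (λ k′ → f k′ ≟ f k) | Vec.lookup∘tabulate imageMember (f k)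
  ... | yes (k′ , fk′≡fk) | lookup≡ = trans lookup≡ (cong (Vec.lookup S) (f-injective fk′≡fk))
  ... | no ∄k′            | _       = contradiction (k , refl) ∄k′

  lookup-image-true : ∀ y → Vec.lookup image y ≡ true → ∃[ k ] f k ≡ y × Vec.lookup S k ≡ true
  lookup-image-true y lookup≡true with any? (λ k → f k ≟ y) | Vec.lookup∘tabulate imageMember y
  ... | yes (k , fk≡y) | lookup≡ = k , fk≡y , trans (sym lookup≡) lookup≡true
  ... | no _           | lookup≡ = contradiction (trans (sym lookup≡) lookup≡true) λ ()

module Cosets {m n} (H : FinGroup m) (G : FinGroup n) {f : Fin m → Fin n} (f-hom : IsHom H G f)
              (f-injective : Injective _≡_ _≡_ f) where
  private
    module G = Group (asGroup G)
    module H = Group (asGroup H)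
    module GP = GroupProperties (asGroup G)

  coset : Fin n → Fin m → Fin n
  coset y a = f a G.∙ y

  coset-injective : ∀ y → Injective _≡_ _≡_ (coset y)
  coset-injective y {a} {b} fa∙y≡fb∙y = f-injective (GP.∙-cancelʳ y (f a) (f b) fa∙y≡fb∙y)

  cosets-isDecEquivalence : IsDecEquivalence (λ z y → ∃[ a ] coset y a ≡ z)
  cosets-isDecEquivalence = record
    { isEquivalence = record
      { refl  = λ {y} → H.ε , trans (cong (G._∙ y) (IsHom-ε H G f-hom)) (G.identityˡ y)
      ; sym   = λ { {z} {y} (a , fa∙y≡z) → a H.⁻¹ , (begin
          f (a H.⁻¹) G.∙ z           ≡⟨ cong₂ G._∙_ (IsHom-⁻¹ H G f-hom a) (sym fa∙y≡z) ⟩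
          f a G.⁻¹ G.∙ (f a G.∙ y)   ≡⟨ GP.\\-leftDividesʳ (f a) y ⟩
          y                          ∎) }
      ; trans = λ { {z} {y} {x} (a , fa∙y≡z) (b , fb∙x≡y) → a H.∙ b , (begin
          f (a H.∙ b) G.∙ x          ≡⟨ cong (G._∙ x) (f-hom a b) ⟩
          (f a G.∙ f b) G.∙ x        ≡⟨ G.assoc (f a) (f b) x ⟩
          f a G.∙ (f b G.∙ x)        ≡⟨ cong (f a G.∙_) fb∙x≡y ⟩
          f a G.∙ y                  ≡⟨ fa∙y≡z ⟩
          z                          ∎) }
      }
    ; _≟_ = λ z y → any? (λ a → coset y a ≟ z)
    }
    where open ≡-Reasoning

  image-symmetric : ∀ {S} → Symmetric H S → Symmetric G (image f S)
  image-symmetric {S} S-symmetric y y∈ with lookup-image-true f S y (Vec.[]=⇒lookup y∈)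
  ... | k , refl , k∈S = Vec.lookup⇒[]= (f k G.⁻¹) (image f S)
    (trans (cong (Vec.lookup (image f S)) (sym (IsHom-⁻¹ H G f-hom k)))
           (trans (lookup-image f S f-injective (k H.⁻¹)) (Vec.[]=⇒lookup (S-symmetric k (Vec.lookup⇒[]= k S k∈S)))))

  cayleyAdj-image : ∀ {S} y a b → cayleyAdj G (image f S) (coset y a) (coset y b) ≡ cayleyAdj H S a b
  cayleyAdj-image {S} y a b = cong (if_then 1ℤ else 0ℤ) (trans (cong (Vec.lookup (image f S)) quotient≡)
                                                          (lookup-image f S f-injective (a H.∙ b H.⁻¹)))
    where
    open ≡-Reasoning
    quotient≡ : coset y a G.∙ coset y b G.⁻¹ ≡ f (a H.∙ b H.⁻¹)
    quotient≡ = begin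
      (f a G.∙ y) G.∙ (f b G.∙ y) G.⁻¹       ≡⟨ cong ((f a G.∙ y) G.∙_) (GP.⁻¹-anti-homo-∙ (f b) y) ⟩
      (f a G.∙ y) G.∙ (y G.⁻¹ G.∙ f b G.⁻¹)  ≡⟨ G.assoc (f a) y (y G.⁻¹ G.∙ f b G.⁻¹) ⟩
      f a G.∙ (y G.∙ (y G.⁻¹ G.∙ f b G.⁻¹))  ≡⟨ cong (f a G.∙_) (GP.\\-leftDividesˡ y (f b G.⁻¹)) ⟩
      f a G.∙ f b G.⁻¹                       ≡⟨ cong (f a G.∙_) (sym (IsHom-⁻¹ H G f-hom b)) ⟩
      f a G.∙ f (b H.⁻¹)                     ≡⟨ sym (f-hom a (b H.⁻¹)) ⟩
      f (a H.∙ b H.⁻¹)                       ∎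

  cayleyAdj-image-offCoset : ∀ {S r c} → ¬ (∃[ a ] coset c a ≡ r) → cayleyAdj G (image f S) r c ≡ 0ℤ
  cayleyAdj-image-offCoset {S} {r} {c} r∉Hc with Vec.lookup (image f S) (r G.∙ c G.⁻¹) in lookup≡
  ... | false = refl
  ... | true with lookup-image-true f S _ lookup≡
  ...   | k , fk≡r/c , _ = contradiction (k , trans (cong (G._∙ c) fk≡r/c) (GP.//-rightDividesˡ c r)) r∉Hc

module _ {m n} (H : FinGroup m) (G : FinGroup n) {f : Fin m → Fin n} (f-hom : IsHom H G f)
         (f-injective : Injective _≡_ _≡_ f) (S : Subset m) where
  open Cosets H G f-hom f-injective
  open IsDecEquivalence cosets-isDecEquivalence using () renaming (refl to coset-refl)

  -- Ordering G by the right cosets of H makes Cay(G, f S) block diagonal, with one copy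
  -- of Cay(H, S) per coset.
  charPoly-image : ∀ x → ∃[ q ] n ≡ q ℕ.* m × charPoly n (cayleyAdj G (image f S)) x ≡ charPoly m (cayleyAdj H S) x ^ q
  charPoly-image x =
    let q , ∣G∣≡ , minor≡ = minor-blockDiagonal (allFin n) (Unique.allFin⁺ n) (λ _ _ → ∈-allFin _)
    in q , trans (sym (length-tabulate id)) ∣G∣≡ , trans (det≡minor n _) minor≡
    where
    on-coset : ∀ y a b → charMatrix x (cayleyAdj G (image f S)) (coset y a) (coset y b) ≡ charMatrix x (cayleyAdj H S) a b
    on-coset y a b = cong₂ (λ d t → x * d - t) (δ-injective (coset-injective y) a b) (cayleyAdj-image y a b)
    off-coset : ∀ {r c} → ¬ (∃[ a ] coset c a ≡ r) → charMatrix x (cayleyAdj G (image f S)) r c ≡ 0ℤ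
    off-coset {r} {c} r∉Hc =
      trans (cong₂ (λ d t → x * d - t)
                   (δ-≢ (λ r≡c → r∉Hc (subst (λ z → ∃[ a ] coset c a ≡ z) (sym r≡c) coset-refl)))
                   (cayleyAdj-image-offCoset r∉Hc))
            (trans (+-identityʳ (x * 0ℤ)) (*-zeroʳ x))
    open BlockDiagonal coset coset-injective cosets-isDecEquivalence
                       (charMatrix x (cayleyAdj G (image f S))) (charMatrix x (cayleyAdj H S)) on-coset off-coset

  charPoly-image-power : ∃[ q ] n ≡ suc q ℕ.* m ×
                         ∀ x → charPoly n (cayleyAdj G (image f S)) x ≡ charPoly m (cayleyAdj H S) x ^ suc q
  charPoly-image-power with charPoly-image 0ℤ
  ... | zero  , n≡0 , _ = contradiction (subst Fin n≡0 (ε G)) λ ()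
  ... | suc q , n≡  , _ = q , n≡ , λ x →
    let q′ , n≡′ , χ≡ = charPoly-image x
    in trans χ≡ (cong (charPoly m (cayleyAdj H S) x ^_) (ℕ.*-cancelʳ-≡ q′ (suc q) m (trans (sym n≡′) n≡)))
    where
    instance
      m≢0 : ℕ.NonZero m
      m≢0 = nonZeroIndex (ε H)

cayleyIntegral-subgroup : ∀ {n m} (G : FinGroup n) (H : FinGroup m) → IsSubgroupOf H G → CayleyIntegral G → CayleyIntegral H
cayleyIntegral-subgroup {n} {m} G H (f , f-hom , f-injective) G-integral S S-symmetric =
  let q , n≡ , χG≡χH^q = charPoly-image-power H G f-hom f-injective S
      μ , χG≡∏ = G-integral (image f S) (Cosets.image-symmetric H G f-hom f-injective S-symmetric)
      χH-monic = charPoly-monic m (cayleyAdj H S)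
  in proj₁ (monicFactors-split n μ (sym n≡) χH-monic (Monic-^ q χH-monic) (λ x → trans (sym (χG≡χH^q x)) (χG≡∏ x)))

module Fibres {n k} (G : FinGroup n) (K : FinGroup k) {f : Fin n → Fin k} (f-hom : IsHom G K f)
              (f-surjective : Surjective _≡_ _≡_ f) where
  private
    module G = Group (asGroup G)
    module K = Group (asGroup K)
    module GP = GroupProperties (asGroup G)

  fibre : Fin k → List (Fin n)
  fibre y = filter (λ z → f z ≟ y) (allFin n)

  -- Right translation by any s ∈ f⁻¹(y) maps the kernel onto the fibre of y.
  length-fibre : ∀ y → length (fibre y) ≡ length (fibre K.ε)
  length-fibre y = trans (sym (↭-length translate)) (length-map (G._∙ s) (fibre K.ε))
    where
    s : Fin n
    s = proj₁ (f-surjective y)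
    fs≡y : f s ≡ y
    fs≡y = proj₂ (f-surjective y) refl
    translate : map (G._∙ s) (fibre K.ε) ↭ fibre y
    translate = unique-sameElements-↭
      (Unique.map⁺ (λ {a} {b} → GP.∙-cancelʳ s a b) (Unique.filter⁺ _ (Unique.allFin⁺ n)))
      (Unique.filter⁺ _ (Unique.allFin⁺ n))
      (λ {z′} z′∈ → let z , z∈ker , z′≡z∙s = ∈-map⁻ (G._∙ s) z′∈
               in ∈-filter⁺ _ (∈-allFin z′) (begin
                    f z′              ≡⟨ cong f z′≡z∙s ⟩
                    f (z G.∙ s)       ≡⟨ f-hom z s ⟩
                    f z K.∙ f s       ≡⟨ cong₂ K._∙_ (proj₂ (∈-filter⁻ _ {xs = allFin n} z∈ker)) fs≡y ⟩
                    K.ε K.∙ y         ≡⟨ K.identityˡ y ⟩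
                    y                 ∎))
      (λ {z} z∈ → subst (_∈ map (G._∙ s) (fibre K.ε)) (GP.//-rightDividesˡ s z)
                    (∈-map⁺ (G._∙ s) (∈-filter⁺ _ (∈-allFin _) (begin
                      f (z G.∙ s G.⁻¹)       ≡⟨ f-hom z (s G.⁻¹) ⟩
                      f z K.∙ f (s G.⁻¹)     ≡⟨ cong₂ K._∙_ (proj₂ (∈-filter⁻ _ {xs = allFin n} z∈))
                                                          (IsHom-⁻¹ G K f-hom s) ⟩
                      y K.∙ f s K.⁻¹         ≡⟨ cong (λ t → y K.∙ t K.⁻¹) fs≡y ⟩
                      y K.∙ y K.⁻¹           ≡⟨ K.inverseʳ y ⟩
                      K.ε                    ∎))))
      where open ≡-Reasoning

  kernelSize : ℕ
  kernelSize = length (fibre K.ε)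

  instance
    kernelSize≢0 : ℕ.NonZero kernelSize
    kernelSize≢0 with fibre K.ε | ∈-filter⁺ (λ z → f z ≟ K.ε) (∈-allFin G.ε) (IsHom-ε G K f-hom)
    ... | _ ∷ _ | _ = _

  module _ (S : Subset k) where
    open Merge f (cayleyAdj K S)

    scaledAdj : Matrix k
    scaledAdj a b = cayleyAdj K S a b * + kernelSize

    private
      compression : Compression (allFin n) (const 1ℤ)
      compression = compress (allFin n) (Unique.allFin⁺ n) (const 1ℤ)
      open Compression compression

      allFin↭targets : allFin k ↭ targets
      allFin↭targets = unique-sameElements-↭ (Unique.allFin⁺ k) targets-unique
        (λ {y} _ → subst (_∈ targets) (proj₂ (f-surjective y) refl) (targets-cover (∈-allFin (proj₁ (f-surjective y)))))
        (λ _ → ∈-allFin _)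

      n≡k+excess : n ≡ k ℕ.+ excess
      n≡k+excess = begin
        n                              ≡⟨ sym (length-tabulate id) ⟩
        length (allFin n)              ≡⟨ length-≡ ⟩
        excess ℕ.+ length targets      ≡⟨ cong (excess ℕ.+_) (sym (↭-length allFin↭targets)) ⟩
        excess ℕ.+ length (allFin k)   ≡⟨ cong (excess ℕ.+_) (length-tabulate id) ⟩
        excess ℕ.+ k                   ≡⟨ ℕ.+-comm excess k ⟩
        k ℕ.+ excess                   ∎
        where open ≡-Reasoning

      fibreSum≡kernelSize : ∀ b → fibreSum (allFin n) (const 1ℤ) b ≡ + kernelSize
      fibreSum≡kernelSize b = trans (fibreSum-ones (allFin n) b) (cong +_ (length-fibre b))

      charPoly≡x^excess* : ∀ x → charPoly n (cayleyAdj G (preimage f S)) x ≡ x ^ excess * charPoly k scaledAdj x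
      charPoly≡x^excess* x = begin
        charPoly n (cayleyAdj G (preimage f S)) x
          ≡⟨ det≡minor n _ ⟩
        minor (charMatrix x (cayleyAdj G (preimage f S))) (allFin n) (allFin n)
          ≡⟨ minor-cong (allFin n) (allFin n) (λ {r} {s} _ _ →
               cong (_-_ (x * δ r s)) (trans (cayleyAdj-preimage G K f-hom {S} r s)
                                              (sym (*-identityʳ (cayleyAdj K S (f r) (f s)))))) ⟩
        minor (charMatrix x (pullback (const 1ℤ))) (allFin n) (allFin n)
          ≡⟨ minor-≡ x ⟩
        x ^ excess * minor (charMatrix x (weighted (fibreSum (allFin n) (const 1ℤ)))) targets targets
          ≡⟨ cong (x ^ excess *_) (minor-↭ _ (↭-sym allFin↭targets)) ⟩
        x ^ excess * minor (charMatrix x (weighted (fibreSum (allFin n) (const 1ℤ)))) (allFin k) (allFin k)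
          ≡⟨ cong (x ^ excess *_) (minor-cong (allFin k) (allFin k) (λ {a} {b} _ _ →
               cong (λ t → x * δ a b - cayleyAdj K S a b * t) (fibreSum≡kernelSize b))) ⟩
        x ^ excess * minor (charMatrix x scaledAdj) (allFin k) (allFin k)
          ≡⟨ cong (x ^ excess *_) (sym (det≡minor k _)) ⟩
        x ^ excess * charPoly k scaledAdj x ∎
        where open ≡-Reasoning

    -- Merging each fibre of f into one point multiplies the kernel size into the adjacency matrix.
    charPoly-preimage : ∃[ e ] n ≡ k ℕ.+ e × ∀ x → charPoly n (cayleyAdj G (preimage f S)) x ≡ x ^ e * charPoly k scaledAdj x
    charPoly-preimage = excess , n≡k+excess , charPoly≡x^excess*

    charPoly-scaledAdj : ∀ y → charPoly k scaledAdj (+ kernelSize * y) ≡ (+ kernelSize) ^ k * charPoly k (cayleyAdj K S) y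
    charPoly-scaledAdj y = begin
      charPoly k scaledAdj (c * y)
        ≡⟨ det≡minor k _ ⟩
      minor (charMatrix (c * y) scaledAdj) (allFin k) (allFin k)
        ≡⟨ minor-cong (allFin k) (allFin k) (λ {a} {b} _ _ → factor-out c y (δ a b) (cayleyAdj K S a b)) ⟩
      minor (λ a b → c * charMatrix y (cayleyAdj K S) a b) (allFin k) (allFin k)
        ≡⟨ minor-scale (charMatrix y (cayleyAdj K S)) c (allFin k) (allFin k) ⟩
      c ^ length (allFin k) * minor (charMatrix y (cayleyAdj K S)) (allFin k) (allFin k)
        ≡⟨ cong₂ (λ e z → c ^ e * z) (length-tabulate {n = k} id) (sym (det≡minor k (charMatrix y (cayleyAdj K S)))) ⟩
      c ^ k * charPoly k (cayleyAdj K S) y ∎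
      where
      open ≡-Reasoning
      c : ℤ
      c = + kernelSize
      factor-out : ∀ c y d A → (c * y) * d - A * c ≡ c * (y * d - A)
      factor-out = solve-∀

cayleyIntegral-quotient : ∀ {n k} (G : FinGroup n) (K : FinGroup k) → IsHomImageOf K G → CayleyIntegral G → CayleyIntegral K
cayleyIntegral-quotient {n} {k} G K (f , f-hom , f-surjective) G-integral S S-symmetric =
  let e , n≡ , χG≡ = charPoly-preimage S
      μ , χG≡∏ = G-integral (preimage f S) (preimage-symmetric G K f-hom S-symmetric)
      scaled-monic = charPoly-monic k (scaledAdj S)
      scaled-splits , _ = monicFactors-split n μ (sym n≡) scaled-monic (x^-monic e)
                            (λ x → trans (*-comm _ (x ^ e)) (trans (sym (χG≡ x)) (χG≡∏ x)))
  in Splits-unscale kernelSize (charPoly-monic k (cayleyAdj K S)) scaled-monic (charPoly-scaledAdj S) scaled-splits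
  where open Fibres G K f-hom f-surjective

lemma4p3 : ∀ {n} (G : FinGroup n) → CayleyIntegral G →
    (∀ {m} (H : FinGroup m) → IsSubgroupOf H G → CayleyIntegral H)
    × (∀ {k} (K : FinGroup k) → IsHomImageOf K G → CayleyIntegral K)
lemma4p3 G G-integral = (λ H H≤G → cayleyIntegral-subgroup G H H≤G G-integral)
                      , (λ K K≼G → cayleyIntegral-quotient G K K≼G G-integral)
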